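{- Let $\alpha_1\ge\alpha_2\ge\alpha_3\ge0$ be integers and $\alpha=(\alpha_1,\alpha_2,\alpha_3,0)$. For every $n\ge3$, $$(\Delta^{(2,1,1)})^2\Delta^{(1^4)}\big(s_{(n+\alpha_1)}s_{(n+\alpha_2)}s_{(n+\alpha_3)}s_{(n)}\big)=\sum_{A}s_{(|a_1|,|a_2|,|a_3|)},$$ where the sum runs over all $A\in P^{\mathbb{Z}}_{4,n,\alpha}$ with $a_{41}=0$, with ($a_{14}=0$ or $a_{31}=0$), and with ($a_{13}=0$ or $a_{32}=0$ or $a_{31}=a_{21}$ or $a_{21}+a_{22}+a_{23}=a_{11}+a_{12}+a_{13}$).
   Context: The product is viewed as the sequence $\{s_{(n+\alpha_1)}s_{(n+\alpha_2)}s_{(n+\alpha_3)}s_{(n)}\}_n$, with $f_n$ homogeneous of degree $4n+\alpha_1+\alpha_2+\alpha_3$. For partitions $\lambda=(\lambda_1,\dots,\lambda_l)$, $\mu=(\mu_1,\dots,\mu_r)$ with $l\le r$, $\lambda+\mu=\mu+\lambda=(\lambda_1+\mu_1,\dots,\lambda_l+\mu_l,\mu_{l+1},\dots,\mu_r)$; for $f=\sum c_\nu s_\nu$, $f+\lambda:=\sum c_\nu s_{\nu+\lambda}$. For a partition $\lambda$ with $|\lambda|=4$, $\Delta^\lambda$ acts termwise by $\Delta^\lambda f_n=f_n-(f_{n-1}+\lambda)$; products/powers are compositions; $(1^4)=(1,1,1,1)$. A partial matrix $A=(a_{ij})$ has entries indexed by $1\le i\le4$, $1\le j\le 5-i$,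 rows $a_i$, $|a_i|=\sum_j a_{ij}$. $P_{4,n,\alpha}$ is the set of real partial matrices with $0\le a_{ij}\le n+\alpha_{i+j-1}$; $\sum_{j=1}^{m}a_{ij}\le\sum_{j=1}^{m}a_{(i-1)j}$ for $2\le i\le4$, $1\le m\le5-i$; and $\sum_{i=1}^{m}a_{i,m+1-i}=n+\alpha_m$ for $1\le m\le4$ (with $\alpha_4=0$). $P^{\mathbb{Z}}_{4,n,\alpha}$ is its set of integer points. -}

module Defs where

open import Data.Nat using (ℕ; zero; suc; _+_; _∸_; _≤_; _⊓_; _≤ᵇ_; _≤?_; _≟_)
open import Data.Integer using (ℤ; +_) renaming (_+_ to _+ℤ_; -_ to -ℤ_)
open import Data.List using (List; []; _∷_; [_]; map; concatMap; upTo; _++_; filter)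
open import Data.List.Properties using (≡-dec)
open import Data.Product using (_×_; _,_)
open import Data.Sum using (_⊎_)
open import Data.Bool using (if_then_else_)
open import Relation.Nullary using (Dec; yes; no)
open import Relation.Nullary.Decidable using (_×-dec_; _⊎-dec_)
open import Relation.Binary.PropositionalEquality using (_≡_)

-- Partitions are lists of positive naturals in weakly decreasing order
-- (no trailing zeros); the empty partition is [].
-- A symmetric function is represented by its (finite) Schur expansion
--   f = Σ c_ν s_ν   as a formal list of pairs (c_ν , ν).
-- Two such expressions denote the same symmetric function iff all their
-- Schur coefficients agree (Schur functions form a basis).

Comb : Set
Comb = List (ℤ × List ℕ)

coeff : Comb → List ℕ → ℤ
coeff [] ρ = + 0
coeff ((c , ν) ∷ f) ρ with ≡-dec _≟_ ν ρ
... | yes _ = c +ℤ coeff f ρ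
... | no  _ = coeff f ρ

infix 4 _≈_
_≈_ : Comb → Comb → Set
f ≈ g = ∀ ρ → coeff f ρ ≡ coeff g ρ

-- Multiplication by a one-row Schur function s_(k) (Pieri rule):
-- s_λ s_(k) = Σ s_μ over μ ⊇ λ with μ/λ a horizontal strip of size k.

private
  lastRow : ℕ → List (List ℕ)
  lastRow zero    = [ [] ]
  lastRow (suc k) = [ suc k ∷ [] ]

-- strips b λ k : all μ with μ/λ a horizontal strip of size k,
-- where the first row of μ is bounded by b.
strips : ℕ → List ℕ → ℕ → List (List ℕ)
strips b []       k = if k ≤ᵇ b then lastRow k else []
strips b (x ∷ xs) k =
  concatMap (λ d → map (x + d ∷_) (strips x xs (k ∸ d))) (upTo (suc (k ⊓ (b ∸ x))))

pieri : List ℕ → ℕ → List (List ℕ)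
pieri []       k = strips k [] k
pieri (x ∷ xs) k = strips (x + k) (x ∷ xs) k

_·s[_] : Comb → ℕ → Comb
f ·s[ k ] = concatMap (λ { (c , ν) → map (c ,_) (pieri ν k) }) f

one : Comb
one = [ (+ 1 , []) ]

sRow : ℕ → Comb
sRow m = one ·s[ m ]

_−_ : Comb → Comb → Comb
f − g = f ++ map (λ { (c , ν) → (-ℤ c , ν) }) g

addP : List ℕ → List ℕ → List ℕ
addP []       μ        = μ
addP (x ∷ xs) []       = x ∷ xs
addP (x ∷ xs) (y ∷ ys) = x + y ∷ addP xs ys

_⊕_ : Comb → List ℕ → Comb
f ⊕ λ′ = map (λ { (c , ν) → (c , addP ν λ′) }) f

-- sequences {f_n}_n and the operator Δ^λ f_n = f_n − (f_{n−1} + λ)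
-- (at n = 0 we use the convention f_{−1} = 0; irrelevant for n ≥ 3 below)
Seq : Set
Seq = ℕ → Comb

Δ : List ℕ → Seq → Seq
Δ λ′ f zero    = f zero
Δ λ′ f (suc n) = f (suc n) − (f n ⊕ λ′)

fSeq : ℕ → ℕ → ℕ → Seq
fSeq α₁ α₂ α₃ n = ((sRow (n + α₁) ·s[ n + α₂ ]) ·s[ n + α₃ ]) ·s[ n ]

λ211 : List ℕ
λ211 = 2 ∷ 1 ∷ 1 ∷ []

λ1111 : List ℕ
λ1111 = 1 ∷ 1 ∷ 1 ∷ 1 ∷ []

LHS : ℕ → ℕ → ℕ → ℕ → Comb
LHS α₁ α₂ α₃ = Δ λ211 (Δ λ211 (Δ λ1111 (fSeq α₁ α₂ α₃)))

record PM : Set where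
  constructor pm
  field
    a11 a12 a13 a14 : ℕ
    a21 a22 a23     : ℕ
    a31 a32         : ℕ
    a41             : ℕ

open PM public

∣a1∣ ∣a2∣ ∣a3∣ : PM → ℕ
∣a1∣ A = a11 A + a12 A + a13 A + a14 A
∣a2∣ A = a21 A + a22 A + a23 A
∣a3∣ A = a31 A + a32 A

αs : ℕ → ℕ → ℕ → ℕ → ℕ
αs α₁ α₂ α₃ 1 = α₁
αs α₁ α₂ α₃ 2 = α₂
αs α₁ α₂ α₃ 3 = α₃
αs α₁ α₂ α₃ _ = 0

-- A ∈ P^ℤ_{4,n,α}  (nonnegativity is automatic for ℕ entries)
InP : ℕ → ℕ → ℕ → ℕ → PM → Set
InP α₁ α₂ α₃ n A =
  ( (a11 A ≤ n + α 1) × (a12 A ≤ n + α 2) × (a13 A ≤ n + α 3) × (a14 A ≤ n + α 4)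
  × (a21 A ≤ n + α 2) × (a22 A ≤ n + α 3) × (a23 A ≤ n + α 4)
  × (a31 A ≤ n + α 3) × (a32 A ≤ n + α 4)
  × (a41 A ≤ n + α 4) )
  ×
  ( (a21 A ≤ a11 A) × (a21 A + a22 A ≤ a11 A + a12 A)
  × (a21 A + a22 A + a23 A ≤ a11 A + a12 A + a13 A)
  × (a31 A ≤ a21 A) × (a31 A + a32 A ≤ a21 A + a22 A)
  × (a41 A ≤ a31 A) )
  ×
  ( (a11 A ≡ n + α 1) × (a12 A + a21 A ≡ n + α 2)
  × (a13 A + a22 A + a31 A ≡ n + α 3)
  × (a14 A + a23 A + a32 A + a41 A ≡ n + α 4) )
  where α = αs α₁ α₂ α₃

Extra : PM → Set
Extra A =
  (a41 A ≡ 0)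
  × ((a14 A ≡ 0) ⊎ (a31 A ≡ 0))
  × ((a13 A ≡ 0) ⊎ (a32 A ≡ 0) ⊎ (a31 A ≡ a21 A)
     ⊎ (a21 A + a22 A + a23 A ≡ a11 A + a12 A + a13 A))

Sel : ℕ → ℕ → ℕ → ℕ → PM → Set
Sel α₁ α₂ α₃ n A = InP α₁ α₂ α₃ n A × Extra A

sel? : ∀ α₁ α₂ α₃ n (A : PM) → Dec (Sel α₁ α₂ α₃ n A)
sel? α₁ α₂ α₃ n A =
  ( ( (a11 A ≤? n + α 1) ×-dec (a12 A ≤? n + α 2) ×-dec (a13 A ≤? n + α 3) ×-dec (a14 A ≤? n + α 4)
    ×-dec (a21 A ≤? n + α 2) ×-dec (a22 A ≤? n + α 3) ×-dec (a23 A ≤? n + α 4)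
    ×-dec (a31 A ≤? n + α 3) ×-dec (a32 A ≤? n + α 4)
    ×-dec (a41 A ≤? n + α 4) )
  ×-dec
    ( (a21 A ≤? a11 A) ×-dec (a21 A + a22 A ≤? a11 A + a12 A)
    ×-dec (a21 A + a22 A + a23 A ≤? a11 A + a12 A + a13 A)
    ×-dec (a31 A ≤? a21 A) ×-dec (a31 A + a32 A ≤? a21 A + a22 A)
    ×-dec (a41 A ≤? a31 A) )
  ×-dec
    ( (a11 A ≟ n + α 1) ×-dec (a12 A + a21 A ≟ n + α 2)
    ×-dec (a13 A + a22 A + a31 A ≟ n + α 3)
    ×-dec (a14 A + a23 A + a32 A + a41 A ≟ n + α 4) ) )
  ×-dec
  ( (a41 A ≟ 0)
    ×-dec ((a14 A ≟ 0) ⊎-dec (a31 A ≟ 0))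
    ×-dec ((a13 A ≟ 0) ⊎-dec (a32 A ≟ 0) ⊎-dec (a31 A ≟ a21 A)
           ⊎-dec (a21 A + a22 A + a23 A ≟ a11 A + a12 A + a13 A)) )
  where α = αs α₁ α₂ α₃

private
  range : ℕ → List ℕ
  range b = upTo (suc b)

box : ℕ → ℕ → ℕ → ℕ → List PM
box α₁ α₂ α₃ n =
  concatMap (λ x11 → concatMap (λ x12 → concatMap (λ x13 → concatMap (λ x14 →
  concatMap (λ x21 → concatMap (λ x22 → concatMap (λ x23 →
  concatMap (λ x31 → concatMap (λ x32 →
  map (λ x41 → pm x11 x12 x13 x14 x21 x22 x23 x31 x32 x41)
  (range (n + α 4)))
  (range (n + α 4))) (range (n + α 3)))
  (range (n + α 4))) (range (n + α 3))) (range (n + α 2)))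
  (range (n + α 4))) (range (n + α 3))) (range (n + α 2))) (range (n + α 1))
  where α = αs α₁ α₂ α₃

trim3 : ℕ → ℕ → ℕ → List ℕ
trim3 p 0 0 = if p ≤ᵇ 0 then [] else p ∷ []
trim3 p q 0 = p ∷ q ∷ []
trim3 p q r = p ∷ q ∷ r ∷ []

RHS : ℕ → ℕ → ℕ → ℕ → Comb
RHS α₁ α₂ α₃ n =
  map (λ A → (+ 1 , trim3 (∣a1∣ A) (∣a2∣ A) (∣a3∣ A)))
      (filter (sel? α₁ α₂ α₃ n) (box α₁ α₂ α₃ n))

-- Pair a Schur expansion f = Σ c_ν s_ν with a weight t on partitions, eval f t = Σ c_ν t(ν); the
-- coefficient of s_ρ is eval f (δ ρ), so it suffices to evaluate both sides against every t.
-- Multiplying 1 successively by s_(n+α₁), s_(n+α₂), s_(n+α₃), s_(n) adds four horizontal strips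
-- (Pieri rule). Recording the strip added by the k-th factor as the k-th antidiagonal of a partial
-- matrix A turns the conditions on the strips into exactly those defining P^ℤ_{4,n,α}, and the
-- resulting shape is the vector of row sums of A; hence f_n = Σ_{A ∈ P^ℤ_{4,n,α}}
-- s_(|a₁|,|a₂|,|a₃|,a₄₁). Each Δ^λ then cancels f_{n−1} + λ against the matrices of level n
-- obtained from level n − 1 by raising four entries by one: the first column for Δ^(1⁴), the
-- entries a₁₁, a₁₄, a₂₁, a₃₁ for the first Δ^(2,1,1), and a₁₁, a₁₃, a₂₁, a₃₂ for the second. The
-- matrices that are not such raisings are exactly those satisfying the extra conditions of the
-- theorem.

module Submission where

open import Defs
open import Data.Bool using (Bool; true; false; if_then_else_; T)
open import Data.Empty using (⊥; ⊥-elim)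
open import Data.Integer using (ℤ; 0ℤ; 1ℤ) renaming (_+_ to _+ᶻ_; _*_ to _*ᶻ_; _-_ to _-ᶻ_; -_ to -ᶻ_)
open import Data.Integer.Properties as ℤ using ()
open import Data.Integer.Tactic.RingSolver using (solve-∀)
open import Data.List using (List; []; _∷_; _++_; map; concatMap; upTo; applyUpTo; foldl; foldr; filter; length)
open import Data.List.Properties using (≡-dec)
open import Data.Nat as ℕ using (ℕ; zero; suc; _+_; _∸_; _⊓_; _≤_; _<_; _≥_; _≤ᵇ_; _≤?_; _≟_; z≤n; s≤s)
open import Data.Nat.Properties as ℕ using ()
open import Data.Product using (_×_; _,_)
open import Data.Sum using (_⊎_; inj₁; inj₂)
open import Data.Unit using (⊤; tt)
open import Data.Vec as Vec using (Vec; []; _∷_; head; tail; replicate) renaming (_++_ to _++ᵥ_)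
open import Data.Vec.Relation.Binary.Pointwise.Inductive using (Pointwise; []; _∷_)
open import Function using (_⇔_; mk⇔; Equivalence)
open import Relation.Nullary using (Dec; yes; no; does; ¬_)
open import Relation.Nullary.Decidable using (_×-dec_; _⊎-dec_; ¬?; map′)
open import Relation.Binary.PropositionalEquality using (_≡_; _≢_; refl; sym; trans; cong; cong₂; subst; module ≡-Reasoning)

𝟙 : {P : Set} → Dec P → ℤ
𝟙 d = if does d then 1ℤ else 0ℤ

𝟙-yes : {P : Set} (p : Dec P) → P → 𝟙 p ≡ 1ℤ
𝟙-yes (yes _) _  = refl
𝟙-yes (no ¬p) p = ⊥-elim (¬p p)

𝟙*-no : {P : Set} (p : Dec P) {x : ℤ} → ¬ P → 𝟙 p *ᶻ x ≡ 0ℤ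
𝟙*-no (yes p) ¬p = ⊥-elim (¬p p)
𝟙*-no (no _)  _  = refl

module _ {P Q : Set} where

  𝟙*-× : (p : Dec P) (q : Dec Q) (x : ℤ) → 𝟙 p *ᶻ (𝟙 q *ᶻ x) ≡ 𝟙 (p ×-dec q) *ᶻ x
  𝟙*-× (yes _) (yes _) x = cong (1ℤ *ᶻ_) (ℤ.*-identityˡ x)
  𝟙*-× (yes _) (no _)  x = refl
  𝟙*-× (no _)  _       x = refl

  𝟙-split : (p : Dec P) (q : Dec Q) → 𝟙 p ≡ 𝟙 (p ×-dec q) +ᶻ 𝟙 (p ×-dec ¬? q)
  𝟙-split (yes _) (yes _) = refl
  𝟙-split (yes _) (no _)  = refl
  𝟙-split (no _)  _       = refl

  𝟙-⇔ : (p : Dec P) (q : Dec Q) → P ⇔ Q → 𝟙 p ≡ 𝟙 q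
  𝟙-⇔ (yes _) (yes _) _   = refl
  𝟙-⇔ (yes p) (no ¬q) p⇔q = ⊥-elim (¬q (Equivalence.to p⇔q p))
  𝟙-⇔ (no ¬p) (yes q) p⇔q = ⊥-elim (¬p (Equivalence.from p⇔q q))
  𝟙-⇔ (no _)  (no _)  _   = refl

  𝟙*-cong : (p : Dec P) (q : Dec Q) {x y : ℤ} →
            (P → Q) → (Q → P) → (P → x ≡ y) → 𝟙 p *ᶻ x ≡ 𝟙 q *ᶻ y
  𝟙*-cong (yes p) (yes _) _ _ x≡y = cong (1ℤ *ᶻ_) (x≡y p)
  𝟙*-cong (yes p) (no ¬q) f _ _   = ⊥-elim (¬q (f p))
  𝟙*-cong (no ¬p) (yes q) _ g _   = ⊥-elim (¬p (g q))
  𝟙*-cong (no _)  (no _)  _ _ _   = refl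

sum< : ℕ → (ℕ → ℤ) → ℤ
sum< zero    h = 0ℤ
sum< (suc n) h = h 0 +ᶻ sum< n (λ i → h (suc i))

sum≤ : ℕ → (ℕ → ℤ) → ℤ
sum≤ b = sum< (suc b)

sum<-cong-< : ∀ n {h h′ : ℕ → ℤ} → (∀ i → i < n → h i ≡ h′ i) → sum< n h ≡ sum< n h′
sum<-cong-< zero    eq = refl
sum<-cong-< (suc n) eq = cong₂ _+ᶻ_ (eq 0 (s≤s z≤n)) (sum<-cong-< n (λ i i<n → eq (suc i) (s≤s i<n)))

sum<-cong : ∀ n {h h′ : ℕ → ℤ} → (∀ i → h i ≡ h′ i) → sum< n h ≡ sum< n h′
sum<-cong n eq = sum<-cong-< n (λ i _ → eq i)

sum<-zero : ∀ n {h : ℕ → ℤ} → (∀ i → i < n → h i ≡ 0ℤ) → sum< n h ≡ 0ℤ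
sum<-zero zero    eq = refl
sum<-zero (suc n) eq = cong₂ _+ᶻ_ (eq 0 (s≤s z≤n)) (sum<-zero n (λ i i<n → eq (suc i) (s≤s i<n)))

sum<-+ : ∀ n (h g : ℕ → ℤ) → sum< n (λ i → h i +ᶻ g i) ≡ sum< n h +ᶻ sum< n g
sum<-+ zero    h g = refl
sum<-+ (suc n) h g = trans (cong (h 0 +ᶻ g 0 +ᶻ_) (sum<-+ n (λ i → h (suc i)) (λ i → g (suc i))))
                           (interchange (h 0) (g 0) _ _)
  where
  interchange : ∀ a b c d → (a +ᶻ b) +ᶻ (c +ᶻ d) ≡ (a +ᶻ c) +ᶻ (b +ᶻ d)
  interchange = solve-∀

sum<-*ˡ : ∀ n c (h : ℕ → ℤ) → c *ᶻ sum< n h ≡ sum< n (λ i → c *ᶻ h i)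
sum<-*ˡ zero    c h = ℤ.*-zeroʳ c
sum<-*ˡ (suc n) c h = trans (ℤ.*-distribˡ-+ c (h 0) _) (cong (c *ᶻ h 0 +ᶻ_) (sum<-*ˡ n c (λ i → h (suc i))))

sum<-swap : ∀ m n (f : ℕ → ℕ → ℤ) →
            sum< m (λ x → sum< n (λ y → f x y)) ≡ sum< n (λ y → sum< m (λ x → f x y))
sum<-swap zero    n f = sym (sum<-zero n (λ _ _ → refl))
sum<-swap (suc m) n f = trans (cong (sum< n (f 0) +ᶻ_) (sum<-swap m n (λ x y → f (suc x) y)))
                              (sym (sum<-+ n (f 0) (λ y → sum< m (λ x → f (suc x) y))))

sum<-extend : ∀ m n (h : ℕ → ℤ) → m ≤ n → (∀ i → m ≤ i → i < n → h i ≡ 0ℤ) → sum< m h ≡ sum< n h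
sum<-extend zero    n       h _         out = sym (sum<-zero n (λ i i<n → out i z≤n i<n))
sum<-extend (suc m) (suc n) h (s≤s m≤n) out =
  cong (h 0 +ᶻ_) (sum<-extend m n (λ i → h (suc i)) m≤n (λ i m≤i i<n → out (suc i) (s≤s m≤i) (s≤s i<n)))

sum<-point : ∀ n r (h : ℕ → ℤ) → r < n → sum< n (λ i → 𝟙 (i ≟ r) *ᶻ h i) ≡ h r
sum<-point (suc n) zero    h _ =
  trans (cong (1ℤ *ᶻ h 0 +ᶻ_) (sum<-zero n (λ _ _ → refl))) (trans (ℤ.+-identityʳ _) (ℤ.*-identityˡ _))
sum<-point (suc n) (suc r) h (s≤s r<n) = trans (ℤ.+-identityˡ _) (sum<-point n r (λ i → h (suc i)) r<n)

_≤*_ : ∀ {k} → Vec ℕ k → Vec ℕ k → Set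
_≤*_ = Pointwise _≤_

shift : ∀ {k} → Vec Bool k → Vec ℕ k → Vec ℕ k
shift []           []       = []
shift (true  ∷ S) (x ∷ v) = suc x ∷ shift S v
shift (false ∷ S) (x ∷ v) = x ∷ shift S v

HitsZero : ∀ {k} → Vec Bool k → Vec ℕ k → Set
HitsZero []           []      = ⊥
HitsZero (true  ∷ S) (x ∷ v) = x ≡ 0 ⊎ HitsZero S v
HitsZero (false ∷ S) (x ∷ v) = HitsZero S v

swapAt : ∀ {A : Set} {k} → ℕ → Vec A k → Vec A k
swapAt zero    (x ∷ y ∷ v) = y ∷ x ∷ v
swapAt (suc i) (x ∷ v)     = x ∷ swapAt i v
swapAt _       v           = v

-- Opaque: unfolding these nested sums during conversion checking is prohibitively slow.
opaque
  boxSum : ∀ {k} → Vec ℕ k → (Vec ℕ k → ℤ) → ℤ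
  boxSum []       w = w []
  boxSum (b ∷ bs) w = sum≤ b (λ x → boxSum bs (λ v → w (x ∷ v)))

  boxSum-[] : (w : Vec ℕ 0 → ℤ) → boxSum [] w ≡ w []
  boxSum-[] w = refl

  boxSum-∷ : ∀ {k} b (bs : Vec ℕ k) (w : Vec ℕ (suc k) → ℤ) →
             boxSum (b ∷ bs) w ≡ sum≤ b (λ x → boxSum bs (λ v → w (x ∷ v)))
  boxSum-∷ b bs w = refl

  boxSum-cong : ∀ {k} (bs : Vec ℕ k) {w w′ : Vec ℕ k → ℤ} → (∀ v → w v ≡ w′ v) → boxSum bs w ≡ boxSum bs w′
  boxSum-cong []       eq = eq []
  boxSum-cong (b ∷ bs) eq = sum<-cong (suc b) (λ x → boxSum-cong bs (λ v → eq (x ∷ v)))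

  boxSum-zero : ∀ {k} (bs : Vec ℕ k) {w : Vec ℕ k → ℤ} → (∀ v → w v ≡ 0ℤ) → boxSum bs w ≡ 0ℤ
  boxSum-zero []       eq = eq []
  boxSum-zero (b ∷ bs) eq = sum<-zero (suc b) (λ x _ → boxSum-zero bs (λ v → eq (x ∷ v)))

  boxSum-+ : ∀ {k} (bs : Vec ℕ k) (w w′ : Vec ℕ k → ℤ) → boxSum bs (λ v → w v +ᶻ w′ v) ≡ boxSum bs w +ᶻ boxSum bs w′
  boxSum-+ []       w w′ = refl
  boxSum-+ (b ∷ bs) w w′ =
    trans (sum<-cong (suc b) (λ x → boxSum-+ bs (λ v → w (x ∷ v)) (λ v → w′ (x ∷ v))))
          (sum<-+ (suc b) (λ x → boxSum bs (λ v → w (x ∷ v))) (λ x → boxSum bs (λ v → w′ (x ∷ v))))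

  boxSum-*ˡ : ∀ {k} (bs : Vec ℕ k) c (w : Vec ℕ k → ℤ) → c *ᶻ boxSum bs w ≡ boxSum bs (λ v → c *ᶻ w v)
  boxSum-*ˡ []       c w = refl
  boxSum-*ˡ (b ∷ bs) c w = trans (sum<-*ˡ (suc b) c (λ x → boxSum bs (λ v → w (x ∷ v))))
                                 (sum<-cong (suc b) (λ x → boxSum-*ˡ bs c (λ v → w (x ∷ v))))

  boxSum-++ : ∀ {k l} (bs : Vec ℕ k) (bs′ : Vec ℕ l) (w : Vec ℕ (k + l) → ℤ) →
              boxSum bs (λ v → boxSum bs′ (λ v′ → w (v ++ᵥ v′))) ≡ boxSum (bs ++ᵥ bs′) w
  boxSum-++ []       bs′ w = refl
  boxSum-++ (b ∷ bs) bs′ w = sum<-cong (suc b) (λ x → boxSum-++ bs bs′ (λ u → w (x ∷ u)))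

  boxSum-extend : ∀ {k} (bs bs′ : Vec ℕ k) (w : Vec ℕ k → ℤ) → bs ≤* bs′ →
                  (∀ v → ¬ v ≤* bs → w v ≡ 0ℤ) → boxSum bs w ≡ boxSum bs′ w
  boxSum-extend []       []         w []           out = refl
  boxSum-extend (b ∷ bs) (b′ ∷ bs′) w (b≤b′ ∷ le) out = trans
    (sum<-cong (suc b) (λ x → boxSum-extend bs bs′ (λ v → w (x ∷ v)) le
      (λ v v≰bs → out (x ∷ v) (λ { (_ ∷ v≤bs) → v≰bs v≤bs }))))
    (sum<-extend (suc b) (suc b′) (λ x → boxSum bs′ (λ v → w (x ∷ v))) (s≤s b≤b′)
      (λ x b<x _ → boxSum-zero bs′ (λ v → out (x ∷ v) (λ { (x≤b ∷ _) → ℕ.<⇒≱ b<x x≤b }))))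

  boxSum-shift : ∀ {k} (S : Vec Bool k) (bs : Vec ℕ k) (w : Vec ℕ k → ℤ) →
                 (∀ v → HitsZero S v → w v ≡ 0ℤ) → boxSum (shift S bs) w ≡ boxSum bs (λ v → w (shift S v))
  boxSum-shift []           []       w _ = refl
  boxSum-shift (true ∷ S)  (b ∷ bs) w z = trans
    (cong (_+ᶻ rest) (boxSum-zero (shift S bs) (λ v → z (0 ∷ v) (inj₁ refl))))
    (trans (ℤ.+-identityˡ rest)
      (sum<-cong (suc b) (λ x → boxSum-shift S bs (λ v → w (suc x ∷ v)) (λ v h → z (suc x ∷ v) (inj₂ h)))))
    where
    rest : ℤ
    rest = sum< (suc b) (λ x → boxSum (shift S bs) (λ v → w (suc x ∷ v)))
  boxSum-shift (false ∷ S) (b ∷ bs) w z =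
    sum<-cong (suc b) (λ x → boxSum-shift S bs (λ v → w (x ∷ v)) (λ v h → z (x ∷ v) h))

  boxSum-swapAt : ∀ {k} i (bs : Vec ℕ k) (w : Vec ℕ k → ℤ) →
                  boxSum bs w ≡ boxSum (swapAt i bs) (λ v → w (swapAt i v))
  boxSum-swapAt zero    []           w = refl
  boxSum-swapAt zero    (b ∷ [])     w = refl
  boxSum-swapAt zero    (b ∷ c ∷ bs) w = sum<-swap (suc b) (suc c) (λ x y → boxSum bs (λ v → w (x ∷ y ∷ v)))
  boxSum-swapAt (suc i) []           w = refl
  boxSum-swapAt (suc i) (b ∷ bs)     w = sum<-cong (suc b) (λ x → boxSum-swapAt i bs (λ v → w (x ∷ v)))

swapsAt : ∀ {A : Set} {k} → List ℕ → Vec A k → Vec A k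
swapsAt []       v = v
swapsAt (i ∷ is) v = swapsAt is (swapAt i v)

unswapsAt : ∀ {A : Set} {k} → List ℕ → Vec A k → Vec A k
unswapsAt []       v = v
unswapsAt (i ∷ is) v = swapAt i (unswapsAt is v)

boxSum-swapsAt : ∀ {k} is (bs : Vec ℕ k) (w : Vec ℕ k → ℤ) →
                 boxSum bs w ≡ boxSum (swapsAt is bs) (λ v → w (unswapsAt is v))
boxSum-swapsAt []       bs w = refl
boxSum-swapsAt (i ∷ is) bs w =
  trans (boxSum-swapAt i bs w) (boxSum-swapsAt is (swapAt i bs) (λ v → w (swapAt i v)))

listSum : {A : Set} → List A → (A → ℤ) → ℤ
listSum []       t = 0ℤ
listSum (x ∷ xs) t = t x +ᶻ listSum xs t

listSum-++ : {A : Set} (xs ys : List A) (t : A → ℤ) → listSum (xs ++ ys) t ≡ listSum xs t +ᶻ listSum ys t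
listSum-++ []       ys t = sym (ℤ.+-identityˡ _)
listSum-++ (x ∷ xs) ys t = trans (cong (t x +ᶻ_) (listSum-++ xs ys t)) (sym (ℤ.+-assoc (t x) _ _))

listSum-*ˡ : {A : Set} (c : ℤ) (xs : List A) (t : A → ℤ) → c *ᶻ listSum xs t ≡ listSum xs (λ x → c *ᶻ t x)
listSum-*ˡ c []       t = ℤ.*-zeroʳ c
listSum-*ˡ c (x ∷ xs) t = trans (ℤ.*-distribˡ-+ c (t x) _) (cong (c *ᶻ t x +ᶻ_) (listSum-*ˡ c xs t))

listSum-map : {A B : Set} (f : A → B) (xs : List A) (t : B → ℤ) → listSum (map f xs) t ≡ listSum xs (λ x → t (f x))
listSum-map f []       t = refl
listSum-map f (x ∷ xs) t = cong (t (f x) +ᶻ_) (listSum-map f xs t)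

listSum-concatMap : {A B : Set} (f : A → List B) (xs : List A) (t : B → ℤ) →
                    listSum (concatMap f xs) t ≡ listSum xs (λ x → listSum (f x) t)
listSum-concatMap f []       t = refl
listSum-concatMap f (x ∷ xs) t = trans (listSum-++ (f x) (concatMap f xs) t)
                                       (cong (listSum (f x) t +ᶻ_) (listSum-concatMap f xs t))

listSum-applyUpTo : ∀ (f : ℕ → ℕ) n (h : ℕ → ℤ) → listSum (applyUpTo f n) h ≡ sum< n (λ i → h (f i))
listSum-applyUpTo f zero    h = refl
listSum-applyUpTo f (suc n) h = cong (h (f 0) +ᶻ_) (listSum-applyUpTo (λ i → f (suc i)) n h)

listSum-upTo : ∀ n (h : ℕ → ℤ) → listSum (upTo n) h ≡ sum< n h
listSum-upTo = listSum-applyUpTo (λ i → i)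

eval : Comb → (List ℕ → ℤ) → ℤ
eval f t = listSum f (λ { (c , ν) → c *ᶻ t ν })

δ : List ℕ → List ℕ → ℤ
δ ρ ν = 𝟙 (≡-dec _≟_ ν ρ)

coeff≡eval-δ : ∀ f ρ → coeff f ρ ≡ eval f (δ ρ)
coeff≡eval-δ []            ρ = refl
coeff≡eval-δ ((c , ν) ∷ f) ρ with ≡-dec _≟_ ν ρ
... | yes _ = cong₂ _+ᶻ_ (sym (ℤ.*-identityʳ c)) (coeff≡eval-δ f ρ)
... | no  _ = trans (coeff≡eval-δ f ρ) (sym (trans (cong (_+ᶻ eval f (δ ρ)) (ℤ.*-zeroʳ c)) (ℤ.+-identityˡ _)))

eval-one : ∀ t → eval one t ≡ t []
eval-one t = trans (ℤ.+-identityʳ _) (ℤ.*-identityˡ _)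

eval-neg : ∀ g t → eval (map (λ { (c , ν) → (-ᶻ c , ν) }) g) t ≡ -ᶻ eval g t
eval-neg []            t = refl
eval-neg ((c , ν) ∷ g) t = trans (cong₂ _+ᶻ_ (sym (ℤ.neg-distribˡ-* c (t ν))) (eval-neg g t))
                                 (sym (ℤ.neg-distrib-+ (c *ᶻ t ν) _))

eval-− : ∀ f g t → eval (f − g) t ≡ eval f t -ᶻ eval g t
eval-− f g t = trans (listSum-++ f _ _) (cong (eval f t +ᶻ_) (eval-neg g t))

eval-⊕ : ∀ f μ t → eval (f ⊕ μ) t ≡ eval f (λ ν → t (addP ν μ))
eval-⊕ []            μ t = refl
eval-⊕ ((c , ν) ∷ f) μ t = cong (c *ᶻ t (addP ν μ) +ᶻ_) (eval-⊕ f μ t)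

eval-Δ : ∀ μ (s : Seq) m t → eval (Δ μ s (suc m)) t ≡ eval (s (suc m)) t -ᶻ eval (s m) (λ ν → t (addP ν μ))
eval-Δ μ s m t = trans (eval-− (s (suc m)) (s m ⊕ μ) t) (cong (λ x → eval (s (suc m)) t -ᶻ x) (eval-⊕ (s m) μ t))

eval-·s : ∀ f k t → eval (f ·s[ k ]) t ≡ eval f (λ ν → listSum (pieri ν k) t)
eval-·s []            k t = refl
eval-·s ((c , ν) ∷ f) k t = begin
  eval (map (c ,_) (pieri ν k) ++ f ·s[ k ]) t
    ≡⟨ listSum-++ (map (c ,_) (pieri ν k)) (f ·s[ k ]) _ ⟩
  eval (map (c ,_) (pieri ν k)) t +ᶻ eval (f ·s[ k ]) t
    ≡⟨ cong₂ _+ᶻ_ (trans (listSum-map (c ,_) (pieri ν k) _) (sym (listSum-*ˡ c (pieri ν k) t))) (eval-·s f k t) ⟩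
  c *ᶻ listSum (pieri ν k) t +ᶻ eval f (λ ν → listSum (pieri ν k) t)
    ∎
  where open ≡-Reasoning

eval-filter : {A : Set} {P : A → Set} (P? : ∀ x → Dec (P x)) (g : A → List ℕ) (xs : List A) (t : List ℕ → ℤ) →
              eval (map (λ x → (1ℤ , g x)) (filter P? xs)) t ≡ listSum xs (λ x → 𝟙 (P? x) *ᶻ t (g x))
eval-filter P? g []       t = refl
eval-filter P? g (x ∷ xs) t with P? x
... | yes _ = cong (1ℤ *ᶻ t (g x) +ᶻ_) (eval-filter P? g xs t)
... | no  _ = trans (eval-filter P? g xs t) (sym (ℤ.+-identityˡ _))

_∷⁺_ : ℕ → List ℕ → List ℕ
zero  ∷⁺ []       = []
zero  ∷⁺ (y ∷ ys) = zero ∷ y ∷ ys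
suc x ∷⁺ ys       = suc x ∷ ys

trim : List ℕ → List ℕ
trim = foldr _∷⁺_ []

firstPart : List ℕ → ℕ
firstPart []      = 0
firstPart (x ∷ _) = x

Partition≤ : ℕ → List ℕ → Set
Partition≤ b []       = ⊤
Partition≤ b (x ∷ xs) = x ≤ b × Partition≤ x xs

Partition≤-mono : ∀ {b b′} xs → b ≤ b′ → Partition≤ b xs → Partition≤ b′ xs
Partition≤-mono []       _    _          = tt
Partition≤-mono (x ∷ xs) b≤b′ (x≤b , xs≤x) = ℕ.≤-trans x≤b b≤b′ , xs≤x

Partition≤-firstPart : ∀ {b} zs k → Partition≤ b zs → Partition≤ (firstPart zs + k) zs
Partition≤-firstPart []       k _          = tt
Partition≤-firstPart (x ∷ xs) k (_ , xs≤x) = ℕ.m≤m+n x k , xs≤x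

-- stripSum b zs k u sums u over zs + d for the horizontal strips d of size k that keep the first row
-- ≤ b, where zs may end in zero rows and d has one row more than zs (as in strips, but without
-- trimming), so that the rows of the result keep their positions.
stripSum : ℕ → List ℕ → ℕ → (List ℕ → ℤ) → ℤ
stripSum b []       k u = if k ≤ᵇ b then u (k ∷ []) else 0ℤ
stripSum b (x ∷ xs) k u = sum≤ (k ⊓ (b ∸ x)) (λ d → stripSum x xs (k ∸ d) (λ ys → u (x + d ∷ ys)))

pieriSum : List ℕ → ℕ → (List ℕ → ℤ) → ℤ
pieriSum zs k = stripSum (firstPart zs + k) zs k

≤ᵇ≡true⇒≤ : ∀ k b → (k ≤ᵇ b) ≡ true → k ≤ b
≤ᵇ≡true⇒≤ k b eq = ℕ.≤ᵇ⇒≤ k b (subst T (sym eq) tt)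

stripSum-cong : ∀ {b} zs k {u u′ : List ℕ → ℤ} → Partition≤ b zs →
                (∀ ys → Partition≤ b ys → u ys ≡ u′ ys) → stripSum b zs k u ≡ stripSum b zs k u′
stripSum-cong {b} [] k _ eq with k ≤ᵇ b in k≤ᵇb
... | true  = eq (k ∷ []) (≤ᵇ≡true⇒≤ k b k≤ᵇb , tt)
... | false = refl
stripSum-cong {b} (x ∷ xs) k (x≤b , xs≤x) eq = sum<-cong-< (suc (k ⊓ (b ∸ x))) (λ d d≤ →
  stripSum-cong xs (k ∸ d) xs≤x (λ ys ys≤x →
    eq (x + d ∷ ys) (x+d≤b (ℕ.≤-trans (ℕ.≤-pred d≤) (ℕ.m⊓n≤n k (b ∸ x))) , Partition≤-mono ys (ℕ.m≤m+n x d) ys≤x)))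
  where
  x+d≤b : ∀ {d} → d ≤ b ∸ x → x + d ≤ b
  x+d≤b {d} d≤ = subst (x + d ≤_) (ℕ.m+[n∸m]≡n x≤b) (ℕ.+-monoʳ-≤ x d≤)

listSum-strips-[] : ∀ b k t → listSum (strips b [] k) t ≡ (if k ≤ᵇ b then t (k ∷⁺ []) else 0ℤ)
listSum-strips-[] b zero    t = ℤ.+-identityʳ _
listSum-strips-[] b (suc k) t with suc k ≤ᵇ b
... | true  = ℤ.+-identityʳ _
... | false = refl

-- Only d = k survives: the remaining size k ∸ d must be zero.
sum≤-collapse : ∀ k b (g : ℕ → ℤ) → sum≤ (k ⊓ b) (λ d → 𝟙 (k ∸ d ≟ 0) *ᶻ g d) ≡ (if k ≤ᵇ b then g k else 0ℤ)
sum≤-collapse k b g with k ≤ᵇ b in k≤ᵇb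
... | true  = begin
  sum≤ (k ⊓ b) (λ d → 𝟙 (k ∸ d ≟ 0) *ᶻ g d)
    ≡⟨ cong (λ r → sum≤ r (λ d → 𝟙 (k ∸ d ≟ 0) *ᶻ g d)) (ℕ.m≤n⇒m⊓n≡m (≤ᵇ≡true⇒≤ k b k≤ᵇb)) ⟩
  sum≤ k (λ d → 𝟙 (k ∸ d ≟ 0) *ᶻ g d)
    ≡⟨ sum<-cong-< (suc k) {h = λ d → 𝟙 (k ∸ d ≟ 0) *ᶻ g d} (λ d d≤k → 𝟙*-cong (k ∸ d ≟ 0) (d ≟ k)
         (λ k∸d≡0 → ℕ.≤-antisym (ℕ.≤-pred d≤k) (ℕ.m∸n≡0⇒m≤n k∸d≡0))
         (λ { refl → ℕ.n∸n≡0 k }) (λ _ → refl)) ⟩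
  sum≤ k (λ d → 𝟙 (d ≟ k) *ᶻ g d)
    ≡⟨ sum<-point (suc k) k g ℕ.≤-refl ⟩
  g k
    ∎
  where open ≡-Reasoning
... | false = sum<-zero (suc (k ⊓ b)) {h = λ d → 𝟙 (k ∸ d ≟ 0) *ᶻ g d} (λ d d≤ → 𝟙*-no (k ∸ d ≟ 0) (λ k∸d≡0 →
  subst T k≤ᵇb (ℕ.≤⇒≤ᵇ (ℕ.≤-trans (ℕ.m∸n≡0⇒m≤n k∸d≡0) (ℕ.≤-trans (ℕ.≤-pred d≤) (ℕ.m⊓n≤n k b))))))

trim-zeros : ∀ xs → Partition≤ 0 xs → trim xs ≡ []
trim-zeros []          _          = refl
trim-zeros (zero ∷ xs) (_ , xs≤0) rewrite trim-zeros xs xs≤0 = refl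

stripSum-zeros : ∀ xs k (u : List ℕ → ℤ) → Partition≤ 0 xs → stripSum 0 xs k u ≡ 𝟙 (k ≟ 0) *ᶻ u (0 ∷ xs)
stripSum-zeros []          zero    u _          = sym (ℤ.*-identityˡ _)
stripSum-zeros []          (suc k) u _          = refl
stripSum-zeros (zero ∷ xs) zero    u (_ , xs≤0) =
  trans (ℤ.+-identityʳ _) (stripSum-zeros xs zero (λ ys → u (0 ∷ ys)) xs≤0)
stripSum-zeros (zero ∷ xs) (suc k) u (_ , xs≤0) =
  trans (ℤ.+-identityʳ _) (stripSum-zeros xs (suc k) (λ ys → u (0 ∷ ys)) xs≤0)

listSum-strips-trim : ∀ b zs k t → Partition≤ b zs →
                      listSum (strips b (trim zs) k) t ≡ stripSum b zs k (λ ys → t (trim ys))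
listSum-strips-trim b []          k t _ = listSum-strips-[] b k t
listSum-strips-trim b (zero ∷ xs) k t (_ , xs≤0) rewrite trim-zeros xs xs≤0 = begin
  listSum (strips b [] k) t
    ≡⟨ listSum-strips-[] b k t ⟩
  (if k ≤ᵇ b then t (k ∷⁺ []) else 0ℤ)
    ≡⟨ sum≤-collapse k b (λ d → t (d ∷⁺ [])) ⟨
  sum≤ (k ⊓ b) (λ d → 𝟙 (k ∸ d ≟ 0) *ᶻ t (d ∷⁺ []))
    ≡⟨ sum<-cong (suc (k ⊓ b)) {h = λ d → 𝟙 (k ∸ d ≟ 0) *ᶻ t (d ∷⁺ [])} (λ d → sym (
         trans (stripSum-zeros xs (k ∸ d) (λ ys → t (trim (d ∷ ys))) xs≤0)
               (cong (λ ν → 𝟙 (k ∸ d ≟ 0) *ᶻ t (d ∷⁺ (0 ∷⁺ ν))) (trim-zeros xs xs≤0)))) ⟩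
  stripSum b (zero ∷ xs) k (λ ys → t (trim ys))
    ∎
  where open ≡-Reasoning
listSum-strips-trim b (suc x ∷ xs) k t (_ , xs≤x) = begin
  listSum (strips b (suc x ∷ trim xs) k) t
    ≡⟨ listSum-concatMap (λ d → map (suc x + d ∷_) (S d)) (upTo r) t ⟩
  listSum (upTo r) (λ d → listSum (map (suc x + d ∷_) (S d)) t)
    ≡⟨ listSum-upTo r (λ d → listSum (map (suc x + d ∷_) (S d)) t) ⟩
  sum< r (λ d → listSum (map (suc x + d ∷_) (S d)) t)
    ≡⟨ sum<-cong r (λ d → trans (listSum-map (suc x + d ∷_) (S d) t)
                                (listSum-strips-trim (suc x) xs (k ∸ d) (λ ν → t (suc x + d ∷ ν)) xs≤x)) ⟩
  stripSum b (suc x ∷ xs) k (λ ys → t (trim ys))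
    ∎
  where
  open ≡-Reasoning
  r : ℕ
  r = suc (k ⊓ (b ∸ suc x))
  S : ℕ → List (List ℕ)
  S d = strips (suc x) (trim xs) (k ∸ d)

listSum-pieri-trim : ∀ {b} zs k t → Partition≤ b zs →
                     listSum (pieri (trim zs) k) t ≡ pieriSum zs k (λ ys → t (trim ys))
listSum-pieri-trim []           k t _       = listSum-strips-trim k [] k t _
listSum-pieri-trim (suc x ∷ xs) k t zs≤b    = listSum-strips-trim (suc x + k) (suc x ∷ xs) k t
                                                (Partition≤-firstPart (suc x ∷ xs) k zs≤b)
listSum-pieri-trim (zero ∷ xs)  k t (_ , xs≤0) =
  trans (cong (λ ν → listSum (pieri ν k) t) trim≡[])
        (trans (cong (λ ν → listSum (strips k ν k) t) (sym trim≡[]))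
               (listSum-strips-trim k (zero ∷ xs) k t (z≤n , xs≤0)))
  where
  trim≡[] : trim (zero ∷ xs) ≡ []
  trim≡[] = cong (zero ∷⁺_) (trim-zeros xs xs≤0)

pieriEval : List ℕ → (List ℕ → ℤ) → List ℕ → ℤ
pieriEval []       t ν = t ν
pieriEval (k ∷ ks) t ν = listSum (pieri ν k) (pieriEval ks t)

pieriChain : List ℕ → (List ℕ → ℤ) → List ℕ → ℤ
pieriChain []       u zs = u zs
pieriChain (k ∷ ks) u zs = pieriSum zs k (pieriChain ks u)

eval-foldl-·s : ∀ ks f t → eval (foldl _·s[_] f ks) t ≡ eval f (pieriEval ks t)
eval-foldl-·s []       f t = refl
eval-foldl-·s (k ∷ ks) f t = trans (eval-foldl-·s ks (f ·s[ k ]) t) (eval-·s f k (pieriEval ks t))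

pieriEval-trim : ∀ ks t {b} zs → Partition≤ b zs → pieriEval ks t (trim zs) ≡ pieriChain ks (λ ys → t (trim ys)) zs
pieriEval-trim []       t zs _    = refl
pieriEval-trim (k ∷ ks) t zs zs≤b =
  trans (listSum-pieri-trim zs k (pieriEval ks t) zs≤b)
        (stripSum-cong zs k (Partition≤-firstPart zs k zs≤b) (λ ys ys≤ → pieriEval-trim ks t ys ys≤))

eval-product : ∀ ks t → eval (foldl _·s[_] one ks) t ≡ pieriChain ks (λ ys → t (trim ys)) []
eval-product ks t = trans (eval-foldl-·s ks one t) (trans (eval-one (pieriEval ks t)) (pieriEval-trim ks t {0} [] tt))

IsStrip : ℕ → (xs : List ℕ) → ℕ → Vec ℕ (suc (length xs)) → Set
IsStrip b []       k ds = head ds ≡ k × head ds ≤ b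
IsStrip b (x ∷ xs) k ds = (head ds ≤ k × head ds ≤ b ∸ x) × IsStrip x xs (k ∸ head ds) (tail ds)

isStrip? : ∀ b xs k ds → Dec (IsStrip b xs k ds)
isStrip? b []       k ds = (head ds ≟ k) ×-dec (head ds ≤? b)
isStrip? b (x ∷ xs) k ds = ((head ds ≤? k) ×-dec (head ds ≤? b ∸ x)) ×-dec isStrip? x xs (k ∸ head ds) (tail ds)

addStrip : (xs : List ℕ) → Vec ℕ (suc (length xs)) → List ℕ
addStrip []       ds = head ds ∷ []
addStrip (x ∷ xs) ds = x + head ds ∷ addStrip xs (tail ds)

if-else-0≡* : ∀ c (x : ℤ) → (if c then x else 0ℤ) ≡ (if c then 1ℤ else 0ℤ) *ᶻ x
if-else-0≡* true  x = sym (ℤ.*-identityˡ x)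
if-else-0≡* false x = refl

sum≤-⊓ : ∀ r M B (h : ℕ → ℤ) → r ≤ B → sum≤ (r ⊓ M) h ≡ sum≤ B (λ d → 𝟙 ((d ≤? r) ×-dec (d ≤? M)) *ᶻ h d)
sum≤-⊓ r M B h r≤B =
  trans (sum<-cong-< (suc (r ⊓ M)) {h = h} {h′ = h′} (λ d d≤ → sym (inside (ℕ.≤-pred d≤))))
        (sum<-extend (suc (r ⊓ M)) (suc B) h′ (s≤s (ℕ.≤-trans (ℕ.m⊓n≤m r M) r≤B))
          (λ d r⊓M<d _ → 𝟙*-no ((d ≤? r) ×-dec (d ≤? M)) (λ (d≤r , d≤M) → ℕ.<⇒≱ r⊓M<d (ℕ.⊓-glb d≤r d≤M))))
  where
  h′ : ℕ → ℤ
  h′ d = 𝟙 ((d ≤? r) ×-dec (d ≤? M)) *ᶻ h d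
  inside : ∀ {d} → d ≤ r ⊓ M → h′ d ≡ h d
  inside {d} d≤ = trans (cong (_*ᶻ h d) (𝟙-yes ((d ≤? r) ×-dec (d ≤? M))
                          (ℕ.≤-trans d≤ (ℕ.m⊓n≤m r M) , ℕ.≤-trans d≤ (ℕ.m⊓n≤n r M))))
                        (ℤ.*-identityˡ (h d))

stripSum≡boxSum : ∀ b xs k B u → k ≤ B →
  stripSum b xs k u ≡ boxSum (replicate (suc (length xs)) B) (λ ds → 𝟙 (isStrip? b xs k ds) *ᶻ u (addStrip xs ds))
stripSum≡boxSum b [] k B u k≤B = sym (begin
  boxSum (B ∷ []) w
    ≡⟨ boxSum-∷ B [] w ⟩
  sum≤ B (λ g → boxSum [] (λ v → w (g ∷ v)))
    ≡⟨ sum<-cong (suc B) (λ g → boxSum-[] (λ v → w (g ∷ v))) ⟩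
  sum≤ B (λ g → 𝟙 ((g ≟ k) ×-dec (g ≤? b)) *ᶻ u (g ∷ []))
    ≡⟨ sum<-cong (suc B) (λ g → sym (𝟙*-× (g ≟ k) (g ≤? b) (u (g ∷ [])))) ⟩
  sum≤ B (λ g → 𝟙 (g ≟ k) *ᶻ (𝟙 (g ≤? b) *ᶻ u (g ∷ [])))
    ≡⟨ sum<-point (suc B) k (λ g → 𝟙 (g ≤? b) *ᶻ u (g ∷ [])) (s≤s k≤B) ⟩
  𝟙 (k ≤? b) *ᶻ u (k ∷ [])
    ≡⟨ if-else-0≡* (k ≤ᵇ b) (u (k ∷ [])) ⟨
  (if k ≤ᵇ b then u (k ∷ []) else 0ℤ)
    ∎)
  where
  open ≡-Reasoning
  w : Vec ℕ 1 → ℤ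
  w ds = 𝟙 (isStrip? b [] k ds) *ᶻ u (addStrip [] ds)
stripSum≡boxSum b (x ∷ xs) k B u k≤B = begin
  sum≤ (k ⊓ (b ∸ x)) H
    ≡⟨ sum≤-⊓ k (b ∸ x) B H k≤B ⟩
  sum≤ B (λ d → 𝟙 (first? d) *ᶻ H d)
    ≡⟨ sum<-cong (suc B) (λ d → trans (cong (𝟙 (first? d) *ᶻ_) (rest d))
         (trans (boxSum-*ˡ R (𝟙 (first? d)) (w d))
                (boxSum-cong R (λ ds → 𝟙*-× (first? d) (isStrip? x xs (k ∸ d) ds) (u (x + d ∷ addStrip xs ds)))))) ⟩
  sum≤ B (λ d → boxSum R (λ ds → strip (d ∷ ds)))
    ≡⟨ boxSum-∷ B R strip ⟨
  boxSum (B ∷ R) strip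
    ∎
  where
  open ≡-Reasoning
  R : Vec ℕ (suc (length xs))
  R = replicate (suc (length xs)) B
  H : ℕ → ℤ
  H d = stripSum x xs (k ∸ d) (λ ys → u (x + d ∷ ys))
  first? : ∀ d → Dec (d ≤ k × d ≤ b ∸ x)
  first? d = (d ≤? k) ×-dec (d ≤? b ∸ x)
  w : ℕ → Vec ℕ (suc (length xs)) → ℤ
  w d ds = 𝟙 (isStrip? x xs (k ∸ d) ds) *ᶻ u (x + d ∷ addStrip xs ds)
  rest : ∀ d → H d ≡ boxSum R (w d)
  rest d = stripSum≡boxSum x xs (k ∸ d) B (λ ys → u (x + d ∷ ys)) (ℕ.≤-trans (ℕ.m∸n≤m k d) k≤B)
  strip : Vec ℕ (suc (suc (length xs))) → ℤ
  strip ds = 𝟙 (isStrip? b (x ∷ xs) k ds) *ᶻ u (addStrip (x ∷ xs) ds)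

𝟙*-pieriSum : ∀ {P : Set} (p : Dec P) zs k u →
  𝟙 p *ᶻ pieriSum zs k u ≡
  boxSum (replicate (suc (length zs)) k) (λ ds → 𝟙 (p ×-dec isStrip? (firstPart zs + k) zs k ds) *ᶻ u (addStrip zs ds))
𝟙*-pieriSum p zs k u =
  trans (cong (𝟙 p *ᶻ_) (stripSum≡boxSum b zs k k u ℕ.≤-refl))
  (trans (boxSum-*ˡ R (𝟙 p) (λ ds → 𝟙 (isStrip? b zs k ds) *ᶻ u (addStrip zs ds)))
         (boxSum-cong R (λ ds → 𝟙*-× p (isStrip? b zs k ds) (u (addStrip zs ds)))))
  where
  b : ℕ
  b = firstPart zs + k
  R : Vec ℕ (suc (length zs))
  R = replicate (suc (length zs)) k

-- A ∈ P^ℤ_{4,n,α} for cₘ = n + αₘ: row i dominates row i+1 in partial sums, and the m-th antidiagonal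
-- sums to cₘ; the entry bounds aᵢⱼ ≤ n + α_{i+j−1} are implied (admissible⇒entries≤).
record Admissible (c₁ c₂ c₃ c₄ : ℕ) (A : PM) : Set where
  constructor admissible
  field
    dom₂₁ : a21 A ≤ a11 A
    dom₂₂ : a21 A + a22 A ≤ a11 A + a12 A
    dom₂₃ : a21 A + a22 A + a23 A ≤ a11 A + a12 A + a13 A
    dom₃₁ : a31 A ≤ a21 A
    dom₃₂ : a31 A + a32 A ≤ a21 A + a22 A
    dom₄₁ : a41 A ≤ a31 A
    diag₁ : a11 A ≡ c₁
    diag₂ : a12 A + a21 A ≡ c₂
    diag₃ : a13 A + a22 A + a31 A ≡ c₃
    diag₄ : a14 A + a23 A + a32 A + a41 A ≡ c₄

open Admissible

admissible? : ∀ c₁ c₂ c₃ c₄ A → Dec (Admissible c₁ c₂ c₃ c₄ A)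
admissible? c₁ c₂ c₃ c₄ A = map′
  (λ (d21 , d22 , d23 , d31 , d32 , d41 , e1 , e2 , e3 , e4) → admissible d21 d22 d23 d31 d32 d41 e1 e2 e3 e4)
  (λ p → dom₂₁ p , dom₂₂ p , dom₂₃ p , dom₃₁ p , dom₃₂ p , dom₄₁ p , diag₁ p , diag₂ p , diag₃ p , diag₄ p)
  ( (a21 A ≤? a11 A) ×-dec (a21 A + a22 A ≤? a11 A + a12 A)
    ×-dec (a21 A + a22 A + a23 A ≤? a11 A + a12 A + a13 A)
    ×-dec (a31 A ≤? a21 A) ×-dec (a31 A + a32 A ≤? a21 A + a22 A) ×-dec (a41 A ≤? a31 A)
    ×-dec (a11 A ≟ c₁) ×-dec (a12 A + a21 A ≟ c₂) ×-dec (a13 A + a22 A + a31 A ≟ c₃)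
    ×-dec (a14 A + a23 A + a32 A + a41 A ≟ c₄) )

-- dₖ is the strip added by the k-th factor s_(cₖ); it is the k-th antidiagonal of the matrix.
StripSequence : (c₁ c₂ c₃ c₄ : ℕ) → Vec ℕ 1 → Vec ℕ 2 → Vec ℕ 3 → Vec ℕ 4 → Set
StripSequence c₁ c₂ c₃ c₄ d₁ d₂ d₃ d₄ =
  ((IsStrip c₁ [] c₁ d₁ × IsStrip (firstPart z₁ + c₂) z₁ c₂ d₂) × IsStrip (firstPart z₂ + c₃) z₂ c₃ d₃)
  × IsStrip (firstPart z₃ + c₄) z₃ c₄ d₄
  where
  z₁ z₂ z₃ : List ℕ
  z₁ = addStrip [] d₁
  z₂ = addStrip z₁ d₂
  z₃ = addStrip z₂ d₃

stripSequence? : ∀ c₁ c₂ c₃ c₄ d₁ d₂ d₃ d₄ → Dec (StripSequence c₁ c₂ c₃ c₄ d₁ d₂ d₃ d₄)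
stripSequence? c₁ c₂ c₃ c₄ d₁ d₂ d₃ d₄ =
  ((isStrip? c₁ [] c₁ d₁ ×-dec isStrip? (firstPart z₁ + c₂) z₁ c₂ d₂) ×-dec isStrip? (firstPart z₂ + c₃) z₂ c₃ d₃)
  ×-dec isStrip? (firstPart z₃ + c₄) z₃ c₄ d₄
  where
  z₁ z₂ z₃ : List ℕ
  z₁ = addStrip [] d₁
  z₂ = addStrip z₁ d₂
  z₃ = addStrip z₂ d₃

private
  ≤∸⇒+≤ : ∀ {m n k} → m ≤ n → k ≤ n ∸ m → m + k ≤ n
  ≤∸⇒+≤ {m} {n} {k} m≤n k≤ = subst (_≤ n) (ℕ.+-comm k m) (ℕ.m≤o∸n⇒m+n≤o k m≤n k≤)

  +≤⇒≤∸ : ∀ {m n k} → m + k ≤ n → k ≤ n ∸ m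
  +≤⇒≤∸ {m} {n} {k} le = ℕ.m+n≤o⇒m≤o∸n k (subst (_≤ n) (ℕ.+-comm m k) le)

  ≡∸⇒+≡ : ∀ {m n k} → m ≤ n → k ≡ n ∸ m → m + k ≡ n
  ≡∸⇒+≡ m≤n refl = ℕ.m+[n∸m]≡n m≤n

  +≡⇒≡∸ : ∀ m {n k} → m + k ≡ n → k ≡ n ∸ m
  +≡⇒≡∸ m {k = k} refl = sym (ℕ.m+n∸m≡n m k)

  ≤+∸ : ∀ m {c k} → k ≤ c → k ≤ m + c ∸ m
  ≤+∸ m {c} k≤c = subst (_ ≤_) (sym (ℕ.m+n∸m≡n m c)) k≤c

  +≡⇒≤ : ∀ m {k n} → m + k ≡ n → m ≤ n
  +≡⇒≤ m {k} refl = ℕ.m≤m+n m k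

stripSequence⇔admissible : ∀ c₁ c₂ c₃ c₄ A →
  StripSequence c₁ c₂ c₃ c₄ (a11 A ∷ []) (a12 A ∷ a21 A ∷ []) (a13 A ∷ a22 A ∷ a31 A ∷ [])
                            (a14 A ∷ a23 A ∷ a32 A ∷ a41 A ∷ [])
  ⇔ Admissible c₁ c₂ c₃ c₄ A
stripSequence⇔admissible c₁ c₂ c₃ c₄ A@(pm a11 a12 a13 a14 a21 a22 a23 a31 a32 a41) = mk⇔ to from
  where
  Strips : Set
  Strips = StripSequence c₁ c₂ c₃ c₄ (a11 ∷ []) (a12 ∷ a21 ∷ []) (a13 ∷ a22 ∷ a31 ∷ []) (a14 ∷ a23 ∷ a32 ∷ a41 ∷ [])

  to : Strips → Admissible c₁ c₂ c₃ c₄ A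
  to ( (((e11 , _)
     , ((a12≤ , _) , (e21 , a21≤a11)))
     , ((a13≤ , _) , ((a22≤ , a22≤′) , (e31 , a31≤a21))))
     , ((a14≤ , _) , ((a23≤ , a23≤′) , ((a32≤ , a32≤′) , (e41 , a41≤a31)))) ) =
    record
      { dom₂₁ = a21≤a11
      ; dom₂₂ = d22
      ; dom₂₃ = ≤∸⇒+≤ (ℕ.≤-trans d22 (ℕ.m≤m+n _ a13)) a23≤′
      ; dom₃₁ = a31≤a21
      ; dom₃₂ = ≤∸⇒+≤ (ℕ.≤-trans a31≤a21 (ℕ.m≤m+n a21 a22)) a32≤′
      ; dom₄₁ = a41≤a31
      ; diag₁ = e11
      ; diag₂ = ≡∸⇒+≡ a12≤ e21
      ; diag₃ = trans (ℕ.+-assoc a13 a22 a31) (≡∸⇒+≡ a13≤ (≡∸⇒+≡ a22≤ e31))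
      ; diag₄ = trans (trans (ℕ.+-assoc (a14 + a23) a32 a41) (ℕ.+-assoc a14 a23 (a32 + a41)))
                      (≡∸⇒+≡ a14≤ (≡∸⇒+≡ a23≤ (≡∸⇒+≡ a32≤ e41)))
      }
    where
    d22 : a21 + a22 ≤ a11 + a12
    d22 = ≤∸⇒+≤ (ℕ.≤-trans a21≤a11 (ℕ.m≤m+n a11 a12)) a22≤′

  from : Admissible c₁ c₂ c₃ c₄ A → Strips
  from p =
    (((diag₁ p , ℕ.≤-reflexive (diag₁ p))
    , ((a12≤ , ≤+∸ a11 a12≤) , (+≡⇒≡∸ a12 (diag₂ p) , dom₂₁ p)))
    , ((a13≤ , ≤+∸ (a11 + a12) a13≤) , ((+≡⇒≤ a22 (+≡⇒≡∸ a13 e3) , +≤⇒≤∸ (dom₂₂ p))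
                                       , (+≡⇒≡∸ a22 (+≡⇒≡∸ a13 e3) , dom₃₁ p))))
    , ((a14≤ , ≤+∸ (a11 + a12 + a13) a14≤)
      , ((+≡⇒≤ a23 (+≡⇒≡∸ a14 e4) , +≤⇒≤∸ (dom₂₃ p))
        , ((+≡⇒≤ a32 (+≡⇒≡∸ a23 (+≡⇒≡∸ a14 e4)) , +≤⇒≤∸ (dom₃₂ p))
          , (+≡⇒≡∸ a32 (+≡⇒≡∸ a23 (+≡⇒≡∸ a14 e4)) , dom₄₁ p))))
    where
    a12≤ : a12 ≤ c₂
    a12≤ = +≡⇒≤ a12 (diag₂ p)
    e3 : a13 + (a22 + a31) ≡ c₃
    e3 = trans (sym (ℕ.+-assoc a13 a22 a31)) (diag₃ p)
    a13≤ : a13 ≤ c₃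
    a13≤ = +≡⇒≤ a13 e3
    e4 : a14 + (a23 + (a32 + a41)) ≡ c₄
    e4 = trans (sym (trans (ℕ.+-assoc (a14 + a23) a32 a41) (ℕ.+-assoc a14 a23 (a32 + a41)))) (diag₄ p)
    a14≤ : a14 ≤ c₄
    a14≤ = +≡⇒≤ a14 e4

toPM : Vec ℕ 10 → PM
toPM (a11 ∷ a12 ∷ a13 ∷ a14 ∷ a21 ∷ a22 ∷ a23 ∷ a31 ∷ a32 ∷ a41 ∷ []) =
  pm a11 a12 a13 a14 a21 a22 a23 a31 a32 a41

fromAntidiagonals : Vec ℕ 10 → PM
fromAntidiagonals (a11 ∷ a12 ∷ a21 ∷ a13 ∷ a22 ∷ a31 ∷ a14 ∷ a23 ∷ a32 ∷ a41 ∷ []) =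
  pm a11 a12 a13 a14 a21 a22 a23 a31 a32 a41

matrixBox : ℕ → ℕ → ℕ → ℕ → Vec ℕ 10
matrixBox c₁ c₂ c₃ c₄ = c₁ ∷ c₂ ∷ c₃ ∷ c₄ ∷ c₂ ∷ c₃ ∷ c₄ ∷ c₃ ∷ c₄ ∷ c₄ ∷ []

antidiagonalBox : ℕ → ℕ → ℕ → ℕ → Vec ℕ 10
antidiagonalBox c₁ c₂ c₃ c₄ = c₁ ∷ c₂ ∷ c₂ ∷ c₃ ∷ c₃ ∷ c₃ ∷ c₄ ∷ c₄ ∷ c₄ ∷ c₄ ∷ []

boxSum-antidiagonals : ∀ c₁ c₂ c₃ c₄ (f : PM → ℤ) →
  boxSum (antidiagonalBox c₁ c₂ c₃ c₄) (λ v → f (fromAntidiagonals v))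
  ≡ boxSum (matrixBox c₁ c₂ c₃ c₄) (λ v → f (toPM v))
boxSum-antidiagonals c₁ c₂ c₃ c₄ f =
  trans (boxSum-swapsAt swaps (antidiagonalBox c₁ c₂ c₃ c₄) (λ v → f (fromAntidiagonals v)))
        (boxSum-cong (matrixBox c₁ c₂ c₃ c₄) {λ v → f (fromAntidiagonals (unswapsAt swaps v))} {λ v → f (toPM v)}
          λ { (_ ∷ _ ∷ _ ∷ _ ∷ _ ∷ _ ∷ _ ∷ _ ∷ _ ∷ _ ∷ []) → refl })
  where
  swaps : List ℕ
  swaps = 2 ∷ 5 ∷ 4 ∷ 3 ∷ 6 ∷ []

rowSums : PM → List ℕ
rowSums A = ∣a1∣ A ∷ ∣a2∣ A ∷ ∣a3∣ A ∷ a41 A ∷ []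

matrixSum : Vec ℕ 10 → {P : PM → Set} → (∀ A → Dec (P A)) → (List ℕ → ℤ) → ℤ
matrixSum B P? u = boxSum B (λ v → 𝟙 (P? (toPM v)) *ᶻ u (rowSums (toPM v)))

boxSum₄ : ℕ → ℕ → ℕ → ℕ → (Vec ℕ 1 → Vec ℕ 2 → Vec ℕ 3 → Vec ℕ 4 → ℤ) → ℤ
boxSum₄ c₁ c₂ c₃ c₄ g =
  boxSum (c₁ ∷ []) λ d₁ → boxSum (c₂ ∷ c₂ ∷ []) λ d₂ → boxSum (c₃ ∷ c₃ ∷ c₃ ∷ []) λ d₃ →
  boxSum (c₄ ∷ c₄ ∷ c₄ ∷ c₄ ∷ []) λ d₄ → g d₁ d₂ d₃ d₄

boxSum₄-cong : ∀ c₁ c₂ c₃ c₄ {g g′ : Vec ℕ 1 → Vec ℕ 2 → Vec ℕ 3 → Vec ℕ 4 → ℤ} →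
               (∀ d₁ d₂ d₃ d₄ → g d₁ d₂ d₃ d₄ ≡ g′ d₁ d₂ d₃ d₄) → boxSum₄ c₁ c₂ c₃ c₄ g ≡ boxSum₄ c₁ c₂ c₃ c₄ g′
boxSum₄-cong c₁ c₂ c₃ c₄ eq =
  boxSum-cong (c₁ ∷ []) λ d₁ → boxSum-cong (c₂ ∷ c₂ ∷ []) λ d₂ → boxSum-cong (c₃ ∷ c₃ ∷ c₃ ∷ []) λ d₃ →
  boxSum-cong (c₄ ∷ c₄ ∷ c₄ ∷ c₄ ∷ []) λ d₄ → eq d₁ d₂ d₃ d₄

boxSum₄-++ : ∀ c₁ c₂ c₃ c₄ (w : Vec ℕ 10 → ℤ) →
  boxSum₄ c₁ c₂ c₃ c₄ (λ d₁ d₂ d₃ d₄ → w (d₁ ++ᵥ d₂ ++ᵥ d₃ ++ᵥ d₄)) ≡ boxSum (antidiagonalBox c₁ c₂ c₃ c₄) w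
boxSum₄-++ c₁ c₂ c₃ c₄ w =
  trans (boxSum-cong R₁ (λ d₁ → boxSum-cong R₂ (λ d₂ → boxSum-++ R₃ R₄ (λ v → w (d₁ ++ᵥ d₂ ++ᵥ v)))))
  (trans (boxSum-cong R₁ (λ d₁ → boxSum-++ R₂ (R₃ ++ᵥ R₄) (λ v → w (d₁ ++ᵥ v))))
         (boxSum-++ R₁ (R₂ ++ᵥ R₃ ++ᵥ R₄) w))
  where
  R₁ : Vec ℕ 1
  R₁ = c₁ ∷ []
  R₂ : Vec ℕ 2
  R₂ = c₂ ∷ c₂ ∷ []
  R₃ : Vec ℕ 3
  R₃ = c₃ ∷ c₃ ∷ c₃ ∷ []
  R₄ : Vec ℕ 4
  R₄ = c₄ ∷ c₄ ∷ c₄ ∷ c₄ ∷ []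

pieriChain≡boxSum₄ : ∀ c₁ c₂ c₃ c₄ u →
  pieriChain (c₁ ∷ c₂ ∷ c₃ ∷ c₄ ∷ []) u [] ≡
  boxSum₄ c₁ c₂ c₃ c₄ (λ d₁ d₂ d₃ d₄ →
    𝟙 (stripSequence? c₁ c₂ c₃ c₄ d₁ d₂ d₃ d₄) *ᶻ u (addStrip (addStrip (addStrip (addStrip [] d₁) d₂) d₃) d₄))
pieriChain≡boxSum₄ c₁ c₂ c₃ c₄ u =
  trans (stripSum≡boxSum c₁ [] c₁ c₁ (pieriChain (c₂ ∷ c₃ ∷ c₄ ∷ []) u) ℕ.≤-refl)
  (boxSum-cong (c₁ ∷ []) λ d₁ →
    let z₁ = addStrip [] d₁
        S₁ = isStrip? c₁ [] c₁ d₁ in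
    trans (𝟙*-pieriSum S₁ z₁ c₂ (pieriChain (c₃ ∷ c₄ ∷ []) u))
    (boxSum-cong (c₂ ∷ c₂ ∷ []) λ d₂ →
      let z₂ = addStrip z₁ d₂
          S₂ = S₁ ×-dec isStrip? (firstPart z₁ + c₂) z₁ c₂ d₂ in
      trans (𝟙*-pieriSum S₂ z₂ c₃ (pieriChain (c₄ ∷ []) u))
      (boxSum-cong (c₃ ∷ c₃ ∷ c₃ ∷ []) λ d₃ →
        𝟙*-pieriSum (S₂ ×-dec isStrip? (firstPart z₂ + c₃) z₂ c₃ d₃) (addStrip z₂ d₃) c₄ u)))

pieriChain≡matrixSum : ∀ c₁ c₂ c₃ c₄ u →
  pieriChain (c₁ ∷ c₂ ∷ c₃ ∷ c₄ ∷ []) u [] ≡ matrixSum (matrixBox c₁ c₂ c₃ c₄) (admissible? c₁ c₂ c₃ c₄) u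
pieriChain≡matrixSum c₁ c₂ c₃ c₄ u = begin
  pieriChain (c₁ ∷ c₂ ∷ c₃ ∷ c₄ ∷ []) u []
    ≡⟨ pieriChain≡boxSum₄ c₁ c₂ c₃ c₄ u ⟩
  boxSum₄ c₁ c₂ c₃ c₄ (λ d₁ d₂ d₃ d₄ →
    𝟙 (stripSequence? c₁ c₂ c₃ c₄ d₁ d₂ d₃ d₄) *ᶻ u (addStrip (addStrip (addStrip (addStrip [] d₁) d₂) d₃) d₄))
    ≡⟨ boxSum₄-cong c₁ c₂ c₃ c₄ (λ { (a11 ∷ []) (a12 ∷ a21 ∷ []) (a13 ∷ a22 ∷ a31 ∷ []) (a14 ∷ a23 ∷ a32 ∷ a41 ∷ []) →
         let A = pm a11 a12 a13 a14 a21 a22 a23 a31 a32 a41 in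
         cong (_*ᶻ u (rowSums A))
              (𝟙-⇔ (stripSequence? c₁ c₂ c₃ c₄ (a11 ∷ []) (a12 ∷ a21 ∷ []) (a13 ∷ a22 ∷ a31 ∷ [])
                                    (a14 ∷ a23 ∷ a32 ∷ a41 ∷ []))
                   (admissible? c₁ c₂ c₃ c₄ A) (stripSequence⇔admissible c₁ c₂ c₃ c₄ A)) }) ⟩
  boxSum₄ c₁ c₂ c₃ c₄ (λ d₁ d₂ d₃ d₄ → w (d₁ ++ᵥ d₂ ++ᵥ d₃ ++ᵥ d₄))
    ≡⟨ boxSum₄-++ c₁ c₂ c₃ c₄ w ⟩
  boxSum (antidiagonalBox c₁ c₂ c₃ c₄) w
    ≡⟨ boxSum-antidiagonals c₁ c₂ c₃ c₄ (λ A → 𝟙 (admissible? c₁ c₂ c₃ c₄ A) *ᶻ u (rowSums A)) ⟩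
  matrixSum (matrixBox c₁ c₂ c₃ c₄) (admissible? c₁ c₂ c₃ c₄) u
    ∎
  where
  open ≡-Reasoning
  w : Vec ℕ 10 → ℤ
  w v = 𝟙 (admissible? c₁ c₂ c₃ c₄ (fromAntidiagonals v)) *ᶻ u (rowSums (fromAntidiagonals v))

admissible⇒entries≤ : ∀ {c₁ c₂ c₃ c₄} A → Admissible c₁ c₂ c₃ c₄ A →
  a11 A ≤ c₁ × a12 A ≤ c₂ × a13 A ≤ c₃ × a14 A ≤ c₄ × a21 A ≤ c₂ × a22 A ≤ c₃ × a23 A ≤ c₄
  × a31 A ≤ c₃ × a32 A ≤ c₄ × a41 A ≤ c₄
admissible⇒entries≤ {c₁} {c₂} {c₃} {c₄} (pm a11 a12 a13 a14 a21 a22 a23 a31 a32 a41) p =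
    ℕ.≤-reflexive (diag₁ p) , ℕ.m+n≤o⇒m≤o a12 d₂ , ℕ.m+n≤o⇒m≤o a13 d₃₂ , ℕ.m+n≤o⇒m≤o a14 d₄₂
  , ℕ.m+n≤o⇒n≤o a12 d₂ , ℕ.m+n≤o⇒n≤o a13 d₃₂ , ℕ.m+n≤o⇒n≤o a14 d₄₂
  , ℕ.m+n≤o⇒n≤o (a13 + a22) d₃ , ℕ.m+n≤o⇒n≤o (a14 + a23) d₄₃
  , ℕ.m+n≤o⇒n≤o (a14 + a23 + a32) d₄
  where
  d₂ : a12 + a21 ≤ c₂
  d₂ = ℕ.≤-reflexive (diag₂ p)
  d₃ : a13 + a22 + a31 ≤ c₃
  d₃ = ℕ.≤-reflexive (diag₃ p)
  d₃₂ : a13 + a22 ≤ c₃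
  d₃₂ = ℕ.m+n≤o⇒m≤o (a13 + a22) d₃
  d₄ : a14 + a23 + a32 + a41 ≤ c₄
  d₄ = ℕ.≤-reflexive (diag₄ p)
  d₄₃ : a14 + a23 + a32 ≤ c₄
  d₄₃ = ℕ.m+n≤o⇒m≤o (a14 + a23 + a32) d₄
  d₄₂ : a14 + a23 ≤ c₄
  d₄₂ = ℕ.m+n≤o⇒m≤o (a14 + a23) d₄₃

admissible⇒≤*matrixBox : ∀ {c₁ c₂ c₃ c₄} v → Admissible c₁ c₂ c₃ c₄ (toPM v) → v ≤* matrixBox c₁ c₂ c₃ c₄
admissible⇒≤*matrixBox v@(_ ∷ _ ∷ _ ∷ _ ∷ _ ∷ _ ∷ _ ∷ _ ∷ _ ∷ _ ∷ []) p =
  let (b11 , b12 , b13 , b14 , b21 , b22 , b23 , b31 , b32 , b41) = admissible⇒entries≤ (toPM v) p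
  in b11 ∷ b12 ∷ b13 ∷ b14 ∷ b21 ∷ b22 ∷ b23 ∷ b31 ∷ b32 ∷ b41 ∷ []

unshift : ∀ {k} → Vec Bool k → Vec ℕ k → Vec ℕ k
unshift []           []       = []
unshift (true  ∷ S) (b ∷ bs) = ℕ.pred b ∷ unshift S bs
unshift (false ∷ S) (b ∷ bs) = b ∷ unshift S bs

shift-unshift-suc : ∀ {k} (S : Vec Bool k) bs → shift S (unshift S (Vec.map suc bs)) ≡ Vec.map suc bs
shift-unshift-suc []           []       = refl
shift-unshift-suc (true  ∷ S) (b ∷ bs) = cong (suc b ∷_) (shift-unshift-suc S bs)
shift-unshift-suc (false ∷ S) (b ∷ bs) = cong (suc b ∷_) (shift-unshift-suc S bs)

≤*-unshift-suc : ∀ {k} (S : Vec Bool k) bs → bs ≤* unshift S (Vec.map suc bs)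
≤*-unshift-suc []           []       = []
≤*-unshift-suc (true  ∷ S) (b ∷ bs) = ℕ.≤-refl ∷ ≤*-unshift-suc S bs
≤*-unshift-suc (false ∷ S) (b ∷ bs) = ℕ.n≤1+n b ∷ ≤*-unshift-suc S bs

shape : PM → List ℕ
shape A = trim (rowSums A)

shapeSum : Vec ℕ 10 → {P : PM → Set} → (∀ A → Dec (P A)) → (List ℕ → ℤ) → ℤ
shapeSum B P? t = matrixSum B P? (λ ν → t (trim ν))

-- Reindex along v ↦ shift S v: the terms of P with a zero in a marked entry vanish, the others are
-- the raisings of the terms of Q.
shapeSum-raise : ∀ (S : Vec Bool 10) B {P Q : PM → Set} (P? : ∀ A → Dec (P A)) (Q? : ∀ A → Dec (Q A))
  (raise : PM → PM) μ t →
  (∀ v → toPM (shift S v) ≡ raise (toPM v)) →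
  (∀ v → HitsZero S v → ¬ P (toPM v)) →
  (∀ A → P (raise A) ⇔ Q A) →
  (∀ v → Q (toPM v) → v ≤* B) →
  (∀ A → shape (raise A) ≡ addP (shape A) μ) →
  shapeSum (Vec.map suc B) P? t ≡ shapeSum B Q? (λ ν → t (addP ν μ))
shapeSum-raise S B {P} P? Q? raise μ t toPM-shift vanish P⇔Q bounded shape-raise = begin
  boxSum (Vec.map suc B) w
    ≡⟨ cong (λ bs → boxSum bs w) (sym (shift-unshift-suc S B)) ⟩
  boxSum (shift S B′) w
    ≡⟨ boxSum-shift S B′ w (λ v hits → 𝟙*-no (P? (toPM v)) (vanish v hits)) ⟩
  boxSum B′ (λ v → w (shift S v))
    ≡⟨ boxSum-cong B′ (λ v → 𝟙*-cong (P? (toPM (shift S v))) (Q? (toPM v))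
         (λ p → to (P⇔Q (toPM v)) (subst P (toPM-shift v) p))
         (λ q → subst P (sym (toPM-shift v)) (from (P⇔Q (toPM v)) q))
         (λ _ → cong t (trans (cong shape (toPM-shift v)) (shape-raise (toPM v))))) ⟩
  boxSum B′ w′
    ≡⟨ boxSum-extend B B′ w′ (≤*-unshift-suc S B) (λ v v≰B → 𝟙*-no (Q? (toPM v)) (λ q → v≰B (bounded v q))) ⟨
  boxSum B w′
    ∎
  where
  open ≡-Reasoning
  open Equivalence
  B′ : Vec ℕ 10
  B′ = unshift S (Vec.map suc B)
  w w′ : Vec ℕ 10 → ℤ
  w v = 𝟙 (P? (toPM v)) *ᶻ t (shape (toPM v))
  w′ v = 𝟙 (Q? (toPM v)) *ᶻ t (addP (shape (toPM v)) μ)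

shapeSum-split : ∀ B {P C : PM → Set} (P? : ∀ A → Dec (P A)) (C? : ∀ A → Dec (C A)) t →
  shapeSum B P? t ≡ shapeSum B (λ A → P? A ×-dec C? A) t +ᶻ shapeSum B (λ A → P? A ×-dec ¬? (C? A)) t
shapeSum-split B P? C? t =
  trans (boxSum-cong B (λ v → trans (cong (_*ᶻ weight v) (𝟙-split (P? (toPM v)) (C? (toPM v))))
                                    (ℤ.*-distribʳ-+ (weight v) (with-C v) (without-C v))))
        (boxSum-+ B (λ v → with-C v *ᶻ weight v) (λ v → without-C v *ᶻ weight v))
  where
  weight with-C without-C : Vec ℕ 10 → ℤ
  weight v = t (shape (toPM v))
  with-C v = 𝟙 (P? (toPM v) ×-dec C? (toPM v))
  without-C v = 𝟙 (P? (toPM v) ×-dec ¬? (C? (toPM v)))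

Δ-shapeSum : ∀ μ (s : Seq) m B {P Q C : PM → Set} (P? : ∀ A → Dec (P A)) (Q? : ∀ A → Dec (Q A))
  (C? : ∀ A → Dec (C A)) →
  (∀ t → eval (s (suc m)) t ≡ shapeSum (Vec.map suc B) P? t) →
  (∀ t → eval (s m) t ≡ shapeSum B Q? t) →
  (∀ t → shapeSum (Vec.map suc B) (λ A → P? A ×-dec ¬? (C? A)) t ≡ shapeSum B Q? (λ ν → t (addP ν μ))) →
  ∀ t → eval (Δ μ s (suc m)) t ≡ shapeSum (Vec.map suc B) (λ A → P? A ×-dec C? A) t
Δ-shapeSum μ s m B P? Q? C? sₘ₊₁ sₘ cancel t = begin
  eval (Δ μ s (suc m)) t
    ≡⟨ eval-Δ μ s m t ⟩
  eval (s (suc m)) t -ᶻ eval (s m) (λ ν → t (addP ν μ))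
    ≡⟨ cong₂ _-ᶻ_ (trans (sₘ₊₁ t) (shapeSum-split (Vec.map suc B) P? C? t))
                  (trans (sₘ (λ ν → t (addP ν μ))) (sym (cancel t))) ⟩
  (with-C +ᶻ without-C) -ᶻ without-C
    ≡⟨ cancelʳ with-C without-C ⟩
  with-C
    ∎
  where
  open ≡-Reasoning
  with-C without-C : ℤ
  with-C = shapeSum (Vec.map suc B) (λ A → P? A ×-dec C? A) t
  without-C = shapeSum (Vec.map suc B) (λ A → P? A ×-dec ¬? (C? A)) t
  cancelʳ : ∀ a b → (a +ᶻ b) -ᶻ b ≡ a
  cancelʳ = solve-∀

Cond₁ Cond₂ Cond₃ : PM → Set
Cond₁ A = a41 A ≡ 0
Cond₂ A = a14 A ≡ 0 ⊎ a31 A ≡ 0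
Cond₃ A = a13 A ≡ 0 ⊎ a32 A ≡ 0 ⊎ a31 A ≡ a21 A ⊎ a21 A + a22 A + a23 A ≡ a11 A + a12 A + a13 A

cond₁? : ∀ A → Dec (Cond₁ A)
cond₁? A = a41 A ≟ 0

cond₂? : ∀ A → Dec (Cond₂ A)
cond₂? A = (a14 A ≟ 0) ⊎-dec (a31 A ≟ 0)

cond₃? : ∀ A → Dec (Cond₃ A)
cond₃? A = (a13 A ≟ 0) ⊎-dec (a32 A ≟ 0) ⊎-dec (a31 A ≟ a21 A)
           ⊎-dec (a21 A + a22 A + a23 A ≟ a11 A + a12 A + a13 A)

raise₁ raise₂ raise₃ : PM → PM
raise₁ A = record A { a11 = suc (a11 A) ; a21 = suc (a21 A) ; a31 = suc (a31 A) ; a41 = suc (a41 A) }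
raise₂ A = record A { a11 = suc (a11 A) ; a14 = suc (a14 A) ; a21 = suc (a21 A) ; a31 = suc (a31 A) }
raise₃ A = record A { a11 = suc (a11 A) ; a13 = suc (a13 A) ; a21 = suc (a21 A) ; a32 = suc (a32 A) }

raised₁ raised₂ raised₃ : Vec Bool 10
raised₁ = true ∷ false ∷ false ∷ false ∷ true ∷ false ∷ false ∷ true ∷ false ∷ true ∷ []
raised₂ = true ∷ false ∷ false ∷ true ∷ true ∷ false ∷ false ∷ true ∷ false ∷ false ∷ []
raised₃ = true ∷ false ∷ true ∷ false ∷ true ∷ false ∷ false ∷ false ∷ true ∷ false ∷ []

toPM-raised₁ : ∀ v → toPM (shift raised₁ v) ≡ raise₁ (toPM v)
toPM-raised₁ (_ ∷ _ ∷ _ ∷ _ ∷ _ ∷ _ ∷ _ ∷ _ ∷ _ ∷ _ ∷ []) = refl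

toPM-raised₂ : ∀ v → toPM (shift raised₂ v) ≡ raise₂ (toPM v)
toPM-raised₂ (_ ∷ _ ∷ _ ∷ _ ∷ _ ∷ _ ∷ _ ∷ _ ∷ _ ∷ _ ∷ []) = refl

toPM-raised₃ : ∀ v → toPM (shift raised₃ v) ≡ raise₃ (toPM v)
toPM-raised₃ (_ ∷ _ ∷ _ ∷ _ ∷ _ ∷ _ ∷ _ ∷ _ ∷ _ ∷ _ ∷ []) = refl

private
  +-suc-injective : ∀ m {n k} → m + suc n ≡ suc k → m + n ≡ k
  +-suc-injective m {n} eq = ℕ.suc-injective (trans (sym (ℕ.+-suc m n)) eq)

  +-suc-cong : ∀ m {n k} → m + n ≡ k → m + suc n ≡ suc k
  +-suc-cong m {n} eq = trans (ℕ.+-suc m n) (cong suc eq)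

admissible-raise₁ : ∀ {c₁ c₂ c₃ c₄} A →
  Admissible (suc c₁) (suc c₂) (suc c₃) (suc c₄) (raise₁ A) ⇔ Admissible c₁ c₂ c₃ c₄ A
admissible-raise₁ A = mk⇔
  (λ p → record
    { dom₂₁ = ℕ.≤-pred (dom₂₁ p) ; dom₂₂ = ℕ.≤-pred (dom₂₂ p) ; dom₂₃ = ℕ.≤-pred (dom₂₃ p)
    ; dom₃₁ = ℕ.≤-pred (dom₃₁ p) ; dom₃₂ = ℕ.≤-pred (dom₃₂ p) ; dom₄₁ = ℕ.≤-pred (dom₄₁ p)
    ; diag₁ = ℕ.suc-injective (diag₁ p)
    ; diag₂ = +-suc-injective (a12 A) (diag₂ p)
    ; diag₃ = +-suc-injective (a13 A + a22 A) (diag₃ p)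
    ; diag₄ = +-suc-injective (a14 A + a23 A + a32 A) (diag₄ p) })
  (λ p → record
    { dom₂₁ = s≤s (dom₂₁ p) ; dom₂₂ = s≤s (dom₂₂ p) ; dom₂₃ = s≤s (dom₂₃ p)
    ; dom₃₁ = s≤s (dom₃₁ p) ; dom₃₂ = s≤s (dom₃₂ p) ; dom₄₁ = s≤s (dom₄₁ p)
    ; diag₁ = cong suc (diag₁ p)
    ; diag₂ = +-suc-cong (a12 A) (diag₂ p)
    ; diag₃ = +-suc-cong (a13 A + a22 A) (diag₃ p)
    ; diag₄ = +-suc-cong (a14 A + a23 A + a32 A) (diag₄ p) })

admissible-raise₂ : ∀ {c₁ c₂ c₃ c₄} A → Cond₁ A →
  Admissible (suc c₁) (suc c₂) (suc c₃) (suc c₄) (raise₂ A) ⇔ Admissible c₁ c₂ c₃ c₄ A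
admissible-raise₂ A a41≡0 = mk⇔
  (λ p → record
    { dom₂₁ = ℕ.≤-pred (dom₂₁ p) ; dom₂₂ = ℕ.≤-pred (dom₂₂ p) ; dom₂₃ = ℕ.≤-pred (dom₂₃ p)
    ; dom₃₁ = ℕ.≤-pred (dom₃₁ p) ; dom₃₂ = ℕ.≤-pred (dom₃₂ p) ; dom₄₁ = a41≤ (a31 A)
    ; diag₁ = ℕ.suc-injective (diag₁ p)
    ; diag₂ = +-suc-injective (a12 A) (diag₂ p)
    ; diag₃ = +-suc-injective (a13 A + a22 A) (diag₃ p)
    ; diag₄ = ℕ.suc-injective (diag₄ p) })
  (λ p → record
    { dom₂₁ = s≤s (dom₂₁ p) ; dom₂₂ = s≤s (dom₂₂ p) ; dom₂₃ = s≤s (dom₂₃ p)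
    ; dom₃₁ = s≤s (dom₃₁ p) ; dom₃₂ = s≤s (dom₃₂ p) ; dom₄₁ = a41≤ (suc (a31 A))
    ; diag₁ = cong suc (diag₁ p)
    ; diag₂ = +-suc-cong (a12 A) (diag₂ p)
    ; diag₃ = +-suc-cong (a13 A + a22 A) (diag₃ p)
    ; diag₄ = cong suc (diag₄ p) })
  where
  a41≤ : ∀ n → a41 A ≤ n
  a41≤ n = subst (_≤ n) (sym a41≡0) z≤n

admissible-raise₃ : ∀ {c₁ c₂ c₃ c₄} A →
  (Admissible (suc c₁) (suc c₂) (suc c₃) (suc c₄) (raise₃ A) × ¬ Cond₃ (raise₃ A)) ⇔ Admissible c₁ c₂ c₃ c₄ A
admissible-raise₃ A@(pm a11 a12 a13 a14 a21 a22 a23 a31 a32 a41) = mk⇔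
  (λ (p , ¬c) → record
    { dom₂₁ = ℕ.≤-pred (dom₂₁ p) ; dom₂₂ = ℕ.≤-pred (dom₂₂ p)
    ; dom₂₃ = ≤suc∧≢⇒≤ (subst (a21 + a22 + a23 ≤_) (ℕ.+-suc (a11 + a12) a13) (ℕ.≤-pred (dom₂₃ p)))
                       (λ e → ¬c (inj₂ (inj₂ (inj₂ (cong suc (trans e (sym (ℕ.+-suc (a11 + a12) a13))))))))
    ; dom₃₁ = ≤suc∧≢⇒≤ (dom₃₁ p) (λ e → ¬c (inj₂ (inj₂ (inj₁ e))))
    ; dom₃₂ = ℕ.≤-pred (subst (_≤ suc (a21 + a22)) (ℕ.+-suc a31 a32) (dom₃₂ p))
    ; dom₄₁ = dom₄₁ p
    ; diag₁ = ℕ.suc-injective (diag₁ p)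
    ; diag₂ = +-suc-injective a12 (diag₂ p)
    ; diag₃ = ℕ.suc-injective (diag₃ p)
    ; diag₄ = ℕ.suc-injective (trans (sym (cong (_+ a41) (ℕ.+-suc (a14 + a23) a32))) (diag₄ p)) })
  (λ p →
    record
      { dom₂₁ = s≤s (dom₂₁ p) ; dom₂₂ = s≤s (dom₂₂ p)
      ; dom₂₃ = s≤s (ℕ.≤-trans (dom₂₃ p) (ℕ.+-monoʳ-≤ (a11 + a12) (ℕ.n≤1+n a13)))
      ; dom₃₁ = ℕ.m≤n⇒m≤1+n (dom₃₁ p)
      ; dom₃₂ = subst (_≤ suc (a21 + a22)) (sym (ℕ.+-suc a31 a32)) (s≤s (dom₃₂ p))
      ; dom₄₁ = dom₄₁ p
      ; diag₁ = cong suc (diag₁ p)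
      ; diag₂ = +-suc-cong a12 (diag₂ p)
      ; diag₃ = cong suc (diag₃ p)
      ; diag₄ = trans (cong (_+ a41) (ℕ.+-suc (a14 + a23) a32)) (cong suc (diag₄ p)) }
    , λ { (inj₁ ())
        ; (inj₂ (inj₁ ()))
        ; (inj₂ (inj₂ (inj₁ e))) → ℕ.<-irrefl refl (subst (_≤ a21) e (dom₃₁ p))
        ; (inj₂ (inj₂ (inj₂ e))) → ℕ.<-irrefl refl
            (subst (_≤ a11 + a12 + a13) (trans (ℕ.suc-injective e) (ℕ.+-suc (a11 + a12) a13)) (dom₂₃ p)) })
  where
  ≤suc∧≢⇒≤ : ∀ {m n} → m ≤ suc n → m ≢ suc n → m ≤ n
  ≤suc∧≢⇒≤ m≤ m≢ = ℕ.≤-pred (ℕ.≤∧≢⇒< m≤ m≢)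

hitsZero₁-excluded : ∀ {c₁ c₂ c₃ c₄} v → HitsZero raised₁ v → ¬ (Admissible c₁ c₂ c₃ c₄ (toPM v) × ¬ Cond₁ (toPM v))
hitsZero₁-excluded (a11 ∷ a12 ∷ a13 ∷ a14 ∷ a21 ∷ a22 ∷ a23 ∷ a31 ∷ a32 ∷ a41 ∷ []) hits (p , ¬c) = ¬c (a41≡0 hits)
  where
  a41≡0 : HitsZero raised₁ (a11 ∷ a12 ∷ a13 ∷ a14 ∷ a21 ∷ a22 ∷ a23 ∷ a31 ∷ a32 ∷ a41 ∷ []) → a41 ≡ 0
  a41≡0 (inj₁ refl)                      = ℕ.n≤0⇒n≡0 (ℕ.≤-trans (dom₄₁ p) (ℕ.≤-trans (dom₃₁ p) (dom₂₁ p)))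
  a41≡0 (inj₂ (inj₁ refl))               = ℕ.n≤0⇒n≡0 (ℕ.≤-trans (dom₄₁ p) (dom₃₁ p))
  a41≡0 (inj₂ (inj₂ (inj₁ refl)))        = ℕ.n≤0⇒n≡0 (dom₄₁ p)
  a41≡0 (inj₂ (inj₂ (inj₂ (inj₁ e))))    = e

hitsZero₂-excluded : ∀ {c₁ c₂ c₃ c₄} v → HitsZero raised₂ v →
          ¬ ((Admissible c₁ c₂ c₃ c₄ (toPM v) × Cond₁ (toPM v)) × ¬ Cond₂ (toPM v))
hitsZero₂-excluded (a11 ∷ a12 ∷ a13 ∷ a14 ∷ a21 ∷ a22 ∷ a23 ∷ a31 ∷ a32 ∷ a41 ∷ []) hits ((p , _) , ¬c) = ¬c (cond hits)
  where
  cond : HitsZero raised₂ (a11 ∷ a12 ∷ a13 ∷ a14 ∷ a21 ∷ a22 ∷ a23 ∷ a31 ∷ a32 ∷ a41 ∷ []) → a14 ≡ 0 ⊎ a31 ≡ 0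
  cond (inj₁ refl)                   = inj₂ (ℕ.n≤0⇒n≡0 (ℕ.≤-trans (dom₃₁ p) (dom₂₁ p)))
  cond (inj₂ (inj₁ e))               = inj₁ e
  cond (inj₂ (inj₂ (inj₁ refl)))     = inj₂ (ℕ.n≤0⇒n≡0 (dom₃₁ p))
  cond (inj₂ (inj₂ (inj₂ (inj₁ e)))) = inj₂ e

hitsZero₃-excluded : ∀ {c₁ c₂ c₃ c₄} v → HitsZero raised₃ v →
          ¬ (((Admissible c₁ c₂ c₃ c₄ (toPM v) × Cond₁ (toPM v)) × Cond₂ (toPM v)) × ¬ Cond₃ (toPM v))
hitsZero₃-excluded (a11 ∷ a12 ∷ a13 ∷ a14 ∷ a21 ∷ a22 ∷ a23 ∷ a31 ∷ a32 ∷ a41 ∷ []) hits (((p , _) , _) , ¬c) = ¬c (cond hits)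
  where
  cond : HitsZero raised₃ (a11 ∷ a12 ∷ a13 ∷ a14 ∷ a21 ∷ a22 ∷ a23 ∷ a31 ∷ a32 ∷ a41 ∷ []) →
         Cond₃ (pm a11 a12 a13 a14 a21 a22 a23 a31 a32 a41)
  cond (inj₁ refl)                   = inj₂ (inj₂ (inj₁ (trans (ℕ.n≤0⇒n≡0 (ℕ.≤-trans (dom₃₁ p) (dom₂₁ p)))
                                                               (sym (ℕ.n≤0⇒n≡0 (dom₂₁ p))))))
  cond (inj₂ (inj₁ e))               = inj₁ e
  cond (inj₂ (inj₂ (inj₁ refl)))     = inj₂ (inj₂ (inj₁ (ℕ.n≤0⇒n≡0 (dom₃₁ p))))
  cond (inj₂ (inj₂ (inj₂ (inj₁ e)))) = inj₂ (inj₁ e)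

addP-∷⁺ : ∀ x ys c cs → addP (x ∷⁺ ys) (c ∷ cs) ≡ x + c ∷ addP ys cs
addP-∷⁺ zero    []       c cs = refl
addP-∷⁺ zero    (y ∷ ys) c cs = refl
addP-∷⁺ (suc x) ys       c cs = refl

addP-[] : ∀ xs → addP xs [] ≡ xs
addP-[] []       = refl
addP-[] (x ∷ xs) = refl

addP-trim-1111 : ∀ p q r s → addP (trim (p ∷ q ∷ r ∷ s ∷ [])) λ1111 ≡ suc p ∷ suc q ∷ suc r ∷ suc s ∷ []
addP-trim-1111 p q r s =
  trans (addP-∷⁺ p _ 1 _) (cong₂ _∷_ (ℕ.+-comm p 1)
  (trans (addP-∷⁺ q _ 1 _) (cong₂ _∷_ (ℕ.+-comm q 1)
  (trans (addP-∷⁺ r _ 1 _) (cong₂ _∷_ (ℕ.+-comm r 1)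
  (trans (addP-∷⁺ s _ 1 _) (cong₂ _∷_ (ℕ.+-comm s 1) refl)))))))

addP-trim-211 : ∀ p q r s → addP (trim (p ∷ q ∷ r ∷ s ∷ [])) λ211 ≡ suc (suc p) ∷ suc q ∷ suc r ∷ trim (s ∷ [])
addP-trim-211 p q r s =
  trans (addP-∷⁺ p _ 2 _) (cong₂ _∷_ (ℕ.+-comm p 2)
  (trans (addP-∷⁺ q _ 1 _) (cong₂ _∷_ (ℕ.+-comm q 1)
  (trans (addP-∷⁺ r _ 1 _) (cong₂ _∷_ (ℕ.+-comm r 1) (addP-[] (trim (s ∷ []))))))))

shape-raise₁ : ∀ A → shape (raise₁ A) ≡ addP (shape A) λ1111
shape-raise₁ A = sym (addP-trim-1111 (∣a1∣ A) (∣a2∣ A) (∣a3∣ A) (a41 A))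

shape-raise₂ : ∀ A → shape (raise₂ A) ≡ addP (shape A) λ211
shape-raise₂ A@(pm a11 a12 a13 a14 a21 a22 a23 a31 a32 a41) =
  trans (cong (λ x → trim (suc x ∷ suc (∣a2∣ A) ∷ suc (∣a3∣ A) ∷ a41 ∷ [])) (ℕ.+-suc (a11 + a12 + a13) a14))
        (sym (addP-trim-211 (∣a1∣ A) (∣a2∣ A) (∣a3∣ A) a41))

shape-raise₃ : ∀ A → shape (raise₃ A) ≡ addP (shape A) λ211
shape-raise₃ A@(pm a11 a12 a13 a14 a21 a22 a23 a31 a32 a41) =
  trans (cong₂ (λ x y → trim (suc (x + a14) ∷ suc (∣a2∣ A) ∷ y ∷ a41 ∷ []))
               (ℕ.+-suc (a11 + a12) a13) (ℕ.+-suc a31 a32))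
        (sym (addP-trim-211 (∣a1∣ A) (∣a2∣ A) (∣a3∣ A) a41))

enumerateBox : ∀ {A : Set} {k} → Vec ℕ (suc k) → (Vec ℕ (suc k) → A) → List A
enumerateBox {k = zero}  (b ∷ []) f = map (λ x → f (x ∷ [])) (upTo (suc b))
enumerateBox {k = suc k} (b ∷ bs) f = concatMap (λ x → enumerateBox bs (λ v → f (x ∷ v))) (upTo (suc b))

listSum-enumerateBox : ∀ {A : Set} {k} (bs : Vec ℕ (suc k)) (f : Vec ℕ (suc k) → A) (g : A → ℤ) →
                       listSum (enumerateBox bs f) g ≡ boxSum bs (λ v → g (f v))
listSum-enumerateBox {k = zero} (b ∷ []) f g =
  trans (listSum-map (λ x → f (x ∷ [])) (upTo (suc b)) g)
  (trans (listSum-upTo (suc b) (λ x → g (f (x ∷ []))))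
  (sym (trans (boxSum-∷ b [] (λ v → g (f v))) (sum<-cong (suc b) (λ x → boxSum-[] (λ v → g (f (x ∷ v))))))))
listSum-enumerateBox {k = suc k} (b ∷ bs) f g =
  trans (listSum-concatMap (λ x → enumerateBox bs (λ v → f (x ∷ v))) (upTo (suc b)) g)
  (trans (listSum-upTo (suc b) (λ x → listSum (enumerateBox bs (λ v → f (x ∷ v))) g))
  (trans (sum<-cong (suc b) (λ x → listSum-enumerateBox bs (λ v → f (x ∷ v)) g))
         (sym (boxSum-∷ b bs (λ v → g (f v))))))

module _ (α₁ α₂ α₃ : ℕ) where

  private
    α : ℕ → ℕ
    α = αs α₁ α₂ α₃

  Box : ℕ → Vec ℕ 10
  Box m = matrixBox (m + α 1) (m + α 2) (m + α 3) (m + α 4)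

  Stage₀ Stage₁ Stage₂ Stage₃ : ℕ → PM → Set
  Stage₀ m = Admissible (m + α 1) (m + α 2) (m + α 3) (m + α 4)
  Stage₁ m A = Stage₀ m A × Cond₁ A
  Stage₂ m A = Stage₁ m A × Cond₂ A
  Stage₃ m A = Stage₂ m A × Cond₃ A

  stage₀? : ∀ m A → Dec (Stage₀ m A)
  stage₀? m = admissible? (m + α 1) (m + α 2) (m + α 3) (m + α 4)

  stage₁? : ∀ m A → Dec (Stage₁ m A)
  stage₁? m A = stage₀? m A ×-dec cond₁? A

  stage₂? : ∀ m A → Dec (Stage₂ m A)
  stage₂? m A = stage₁? m A ×-dec cond₂? A

  stage₃? : ∀ m A → Dec (Stage₃ m A)
  stage₃? m A = stage₂? m A ×-dec cond₃? A

  private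
    f : Seq
    f = fSeq α₁ α₂ α₃
    open Equivalence

  eval-f : ∀ m t → eval (f m) t ≡ shapeSum (Box m) (stage₀? m) t
  eval-f m t =
    trans (eval-product (m + α₁ ∷ m + α₂ ∷ m + α₃ ∷ m ∷ []) t)
    (trans (pieriChain≡matrixSum (m + α₁) (m + α₂) (m + α₃) m (λ ν → t (trim ν)))
           (cong (λ c → matrixSum (matrixBox (m + α₁) (m + α₂) (m + α₃) c) (admissible? (m + α₁) (m + α₂) (m + α₃) c)
                                  (λ ν → t (trim ν)))
                 {m} {m + 0} (sym (ℕ.+-identityʳ m))))

  cancel₁ : ∀ m t → shapeSum (Box (suc m)) (λ A → stage₀? (suc m) A ×-dec ¬? (cond₁? A)) t
                  ≡ shapeSum (Box m) (stage₀? m) (λ ν → t (addP ν λ1111))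
  cancel₁ m t = shapeSum-raise raised₁ (Box m) (λ A → stage₀? (suc m) A ×-dec ¬? (cond₁? A)) (stage₀? m)
    raise₁ λ1111 t toPM-raised₁ hitsZero₁-excluded
    (λ A → mk⇔ (λ (p , _) → to (admissible-raise₁ A) p) (λ q → from (admissible-raise₁ A) q , λ ()))
    admissible⇒≤*matrixBox shape-raise₁

  cancel₂ : ∀ m t → shapeSum (Box (suc m)) (λ A → stage₁? (suc m) A ×-dec ¬? (cond₂? A)) t
                  ≡ shapeSum (Box m) (stage₁? m) (λ ν → t (addP ν λ211))
  cancel₂ m t = shapeSum-raise raised₂ (Box m) (λ A → stage₁? (suc m) A ×-dec ¬? (cond₂? A)) (stage₁? m)
    raise₂ λ211 t toPM-raised₂ hitsZero₂-excluded
    (λ A → mk⇔ (λ ((p , z) , _) → to (admissible-raise₂ A z) p , z)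
               (λ (q , z) → (from (admissible-raise₂ A z) q , z) , λ { (inj₁ ()) ; (inj₂ ()) }))
    (λ v (q , _) → admissible⇒≤*matrixBox v q) shape-raise₂

  cancel₃ : ∀ m t → shapeSum (Box (suc m)) (λ A → stage₂? (suc m) A ×-dec ¬? (cond₃? A)) t
                  ≡ shapeSum (Box m) (stage₂? m) (λ ν → t (addP ν λ211))
  cancel₃ m t = shapeSum-raise raised₃ (Box m) (λ A → stage₂? (suc m) A ×-dec ¬? (cond₃? A)) (stage₂? m)
    raise₃ λ211 t toPM-raised₃ hitsZero₃-excluded
    (λ A → mk⇔ (λ (((p , z) , c) , ¬c) → (to (admissible-raise₃ A) (p , ¬c) , z) , c)
               (λ ((q , z) , c) → let (p , ¬c) = from (admissible-raise₃ A) q in ((p , z) , c) , ¬c))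
    (λ v ((q , _) , _) → admissible⇒≤*matrixBox v q) shape-raise₃

  eval-Δf : ∀ m t → eval (Δ λ1111 f (suc m)) t ≡ shapeSum (Box (suc m)) (stage₁? (suc m)) t
  eval-Δf m = Δ-shapeSum λ1111 f m (Box m) (stage₀? (suc m)) (stage₀? m) cond₁?
                (eval-f (suc m)) (eval-f m) (cancel₁ m)

  eval-ΔΔf : ∀ m t → eval (Δ λ211 (Δ λ1111 f) (2 + m)) t ≡ shapeSum (Box (2 + m)) (stage₂? (2 + m)) t
  eval-ΔΔf m = Δ-shapeSum λ211 (Δ λ1111 f) (suc m) (Box (suc m)) (stage₁? (2 + m)) (stage₁? (suc m)) cond₂?
                 (eval-Δf (suc m)) (eval-Δf m) (cancel₂ (suc m))

  eval-LHS : ∀ m t → eval (LHS α₁ α₂ α₃ (3 + m)) t ≡ shapeSum (Box (3 + m)) (stage₃? (3 + m)) t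
  eval-LHS m = Δ-shapeSum λ211 (Δ λ211 (Δ λ1111 f)) (2 + m) (Box (2 + m)) (stage₂? (3 + m)) (stage₂? (2 + m)) cond₃?
                 (eval-ΔΔf (suc m)) (eval-ΔΔf m) (cancel₃ (2 + m))

  InP⇔Stage₀ : ∀ n A → InP α₁ α₂ α₃ n A ⇔ Stage₀ n A
  InP⇔Stage₀ n A = mk⇔
    (λ (_ , (d21 , d22 , d23 , d31 , d32 , d41) , (e1 , e2 , e3 , e4)) →
       admissible d21 d22 d23 d31 d32 d41 e1 e2 e3 e4)
    (λ p → admissible⇒entries≤ A p
         , (dom₂₁ p , dom₂₂ p , dom₂₃ p , dom₃₁ p , dom₃₂ p , dom₄₁ p)
         , (diag₁ p , diag₂ p , diag₃ p , diag₄ p))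

  trim3≡shape : ∀ A → Cond₁ A → trim3 (∣a1∣ A) (∣a2∣ A) (∣a3∣ A) ≡ shape A
  trim3≡shape A a41≡0 =
    trans (trim3≡trim (∣a1∣ A) (∣a2∣ A) (∣a3∣ A)) (cong (λ s → trim (∣a1∣ A ∷ ∣a2∣ A ∷ ∣a3∣ A ∷ s ∷ [])) (sym a41≡0))
    where
    trim3≡trim : ∀ p q r → trim3 p q r ≡ trim (p ∷ q ∷ r ∷ 0 ∷ [])
    trim3≡trim zero    zero    zero    = refl
    trim3≡trim zero    zero    (suc r) = refl
    trim3≡trim zero    (suc q) zero    = refl
    trim3≡trim zero    (suc q) (suc r) = refl
    trim3≡trim (suc p) zero    zero    = refl
    trim3≡trim (suc p) zero    (suc r) = refl
    trim3≡trim (suc p) (suc q) zero    = refl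
    trim3≡trim (suc p) (suc q) (suc r) = refl

  coeff-RHS : ∀ n ρ → coeff (RHS α₁ α₂ α₃ n) ρ ≡ shapeSum (Box n) (stage₃? n) (δ ρ)
  coeff-RHS n ρ =
    trans (coeff≡eval-δ (RHS α₁ α₂ α₃ n) ρ)
    (trans (eval-filter (sel? α₁ α₂ α₃ n) row3 (box α₁ α₂ α₃ n) (δ ρ))
    (trans (listSum-enumerateBox (Box n) toPM (λ A → 𝟙 (sel? α₁ α₂ α₃ n A) *ᶻ δ ρ (row3 A)))
           (boxSum-cong (Box n) (λ v → 𝟙*-cong (sel? α₁ α₂ α₃ n (toPM v)) (stage₃? n (toPM v))
             (λ (inP , a41≡0 , c₂ , c₃) → ((to (InP⇔Stage₀ n (toPM v)) inP , a41≡0) , c₂) , c₃)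
             (λ (((p , a41≡0) , c₂) , c₃) → from (InP⇔Stage₀ n (toPM v)) p , a41≡0 , c₂ , c₃)
             (λ (_ , a41≡0 , _) → cong (δ ρ) (trim3≡shape (toPM v) a41≡0))))))
    where
    row3 : PM → List ℕ
    row3 A = trim3 (∣a1∣ A) (∣a2∣ A) (∣a3∣ A)

mainTheorem8 : (α₁ α₂ α₃ : ℕ) → α₁ ≥ α₂ → α₂ ≥ α₃ → (n : ℕ) → 3 ≤ n →
               LHS α₁ α₂ α₃ n ≈ RHS α₁ α₂ α₃ n
mainTheorem8 α₁ α₂ α₃ _ _ (suc (suc (suc m))) (s≤s (s≤s (s≤s _))) ρ = begin
  coeff (LHS α₁ α₂ α₃ (3 + m)) ρ                        ≡⟨ coeff≡eval-δ (LHS α₁ α₂ α₃ (3 + m)) ρ ⟩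
  eval (LHS α₁ α₂ α₃ (3 + m)) (δ ρ)                     ≡⟨ eval-LHS α₁ α₂ α₃ m (δ ρ) ⟩
  shapeSum (Box α₁ α₂ α₃ (3 + m)) (stage₃? α₁ α₂ α₃ (3 + m)) (δ ρ) ≡⟨ coeff-RHS α₁ α₂ α₃ (3 + m) ρ ⟨
  coeff (RHS α₁ α₂ α₃ (3 + m)) ρ                        ∎
  where open ≡-Reasoning
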